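{- For $n \ge 3$, let $W_{1,n} = C_n + K_1$. Then $\dim(L(W_{1,n})) = 3$ if $n \in \{3,4\}$, $\dim(L(W_{1,n})) = 4$ if $n = 5$, and $\dim(L(W_{1,n})) = n - \lceil n/3 \rceil$ if $n \ge 6$.
   Context: All graphs are finite, simple, undirected and connected. For a graph $H$, a set $W \subseteq V(H)$ is a resolving set if for every pair of distinct vertices $u,v$ there is $x \in W$ with $d(u,x) \ne d(v,x)$ ($d$ the shortest-path distance); $\dim(H)$ is the minimum cardinality of a resolving set. $L(G)$ is the line graph of $G$. $W_{1,n} = C_n + K_1$ is the join of the cycle $C_n$ with one extra vertex adjacent to all vertices of $C_n$. -}

module Defs where

open import Data.Nat using (ℕ; zero; suc; _+_; _∸_; _≤_; _<_; _≡ᵇ_)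
open import Data.Nat.DivMod using (_/_)
open import Data.Fin using (Fin; toℕ) renaming (zero to fzero; suc to fsuc)
open import Data.Bool using (Bool; true; false; _∨_; _∧_; T)
open import Data.Product using (Σ; _×_; _,_; proj₁; proj₂; ∃)
open import Data.Sum using (_⊎_)
open import Data.List using (List; length)
open import Data.List.Membership.Propositional using (_∈_)
open import Relation.Binary.PropositionalEquality using (_≡_; _≢_)

record Graph : Set₁ where
  field
    V   : Set
    Adj : V → V → Set

open Graph public

data Walk (G : Graph) : V G → V G → ℕ → Set where
  here : ∀ {u} → Walk G u u 0
  step : ∀ {u w v k} → Adj G u w → Walk G w v k → Walk G u v (suc k)

Dist : (G : Graph) → V G → V G → ℕ → Set
Dist G u v k = Walk G u v k × (∀ j → Walk G u v j → k ≤ j)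

Resolving : (G : Graph) → List (V G) → Set
Resolving G W =
  ∀ u v → u ≢ v →
  Σ (V G) λ x → x ∈ W × Σ ℕ λ k₁ → Σ ℕ λ k₂ →
    Dist G u x k₁ × Dist G v x k₂ × k₁ ≢ k₂

-- dim(G) = k : there is a resolving set of size k and every resolving set
-- has at least k elements (a list with repetitions is at least as long as
-- its underlying set).
MetricDim : Graph → ℕ → Set
MetricDim G k =
  (Σ (List (V G)) λ W → Resolving G W × length W ≡ k) ×
  (∀ W → Resolving G W → k ≤ length W)

FinGraph : (m : ℕ) → (Fin m → Fin m → Bool) → Graph
FinGraph m adj = record { V = Fin m ; Adj = λ a b → T (adj a b) }

-- Line graph of a graph on Fin m with (symmetric, irreflexive) Bool adjacency:
-- vertices are edges {a,b} written with a < b; two distinct edges are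
-- adjacent iff they share an endpoint.
LineGraph : (m : ℕ) → (Fin m → Fin m → Bool) → Graph
LineGraph m adj = record
  { V   = Σ (Fin m × Fin m) λ p → (toℕ (proj₁ p) < toℕ (proj₂ p)) × T (adj (proj₁ p) (proj₂ p))
  ; Adj = λ e f → e ≢ f ×
            ((proj₁ (proj₁ e) ≡ proj₁ (proj₁ f)) ⊎ (proj₁ (proj₁ e) ≡ proj₂ (proj₁ f)) ⊎
             (proj₂ (proj₁ e) ≡ proj₁ (proj₁ f)) ⊎ (proj₂ (proj₁ e) ≡ proj₂ (proj₁ f)))
  }

cycAdj : ℕ → ℕ → ℕ → Bool
cycAdj n a b =
  (suc a ≡ᵇ b) ∨ (suc b ≡ᵇ a) ∨
  ((suc a ≡ᵇ n) ∧ (b ≡ᵇ 0)) ∨ ((suc b ≡ᵇ n) ∧ (a ≡ᵇ 0))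

-- Wheel W_{1,n} = C_n + K_1 on Fin (suc n): vertex fzero is the hub,
-- vertex fsuc i is the i-th cycle vertex.
wheelAdj : (n : ℕ) → Fin (suc n) → Fin (suc n) → Bool
wheelAdj n fzero    fzero    = false
wheelAdj n fzero    (fsuc j) = true
wheelAdj n (fsuc i) fzero    = true
wheelAdj n (fsuc i) (fsuc j) = cycAdj n (toℕ i) (toℕ j)

LineWheel : ℕ → Graph
LineWheel n = LineGraph (suc n) (wheelAdj n)

⌈_/3⌉ : ℕ → ℕ
⌈ n /3⌉ = (n + 2) / 3

module Submission where

-- The edges of W_{1,n} are the spokes {hub, i} and the rims {i, i+1 mod n}, and their distances in
-- L(W_{1,n}) are explicit: spokes are pairwise adjacent, a spoke is adjacent to the two rims at its
-- cycle vertex, and two rims are at distance min(d, 3) when d is their distance along the cycle.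
--
-- Let every landmark cover the cycle vertices it touches, a spoke covering its vertex
-- twice, so that the coverages c_i sum to 2|W|. Two spokes are separated only by a landmark touching
-- exactly one of their cycle vertices; hence at most one c_i vanishes, and if c_i = 1 then i is
-- touched by a single rim whose other endpoint j has c_j ≥ 2. A weight over each window of three
-- consecutive cycle vertices is then at least 4, and summing over the n windows gives
-- 4n ≤ 6|W| + 4, that is |W| ≥ n − ⌈n/3⌉.
--
-- For n ≥ 9 the rims {3t, 3t+1} of every complete block of three cycle vertices, plus
-- the spoke at 3⌊n/3⌋ when n ≡ 2 (mod 3), already resolve L(W_{1,n}). The remaining upper bounds
-- (n ≤ 8) and the lower bounds for n ≤ 5, where counting is not sharp, are settled by computation.

open import Data.Bool using (if_then_else_; _∨_; _∧_; T)
open import Data.Bool.Properties using (T-irrelevant; T-∨; T-∧)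
open import Data.Empty using (⊥; ⊥-elim)
open import Data.Fin using (Fin; toℕ; fromℕ<) renaming (zero to fzero; suc to fsuc)
open import Data.Fin.Properties using (toℕ-injective; toℕ-fromℕ<; toℕ<n)
open import Data.List using (List; []; _∷_; _++_; map; length; upTo; cartesianProductWith)
open import Data.List.Membership.Propositional using (_∈_; find; lose)
open import Data.List.Membership.Propositional.Properties
  using (∈-map⁺; ∈-++⁺ˡ; ∈-++⁺ʳ; ∈-upTo⁺; ∈-upTo⁻; ∈-cartesianProductWith⁺)
open import Data.List.Properties using (length-map; length-++)
open import Data.List.Relation.Unary.All using (All; []; _∷_; all?)
import Data.List.Relation.Unary.All as All
import Data.List.Relation.Unary.All.Properties as All
open import Data.List.Relation.Unary.Any using (Any; here; there; any?)
open import Data.Nat using (ℕ; zero; suc; _+_; _*_; _∸_; _≤_; _<_; _≤ᵇ_; _≡ᵇ_; z≤n; s≤s; s≤s⁻¹; _≟_; _<?_; _≤?_)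
open import Data.Nat.DivMod using (_/_; _%_; m≡m%n+[m/n]*n; m%n<n; m<n*o⇒m/o<n; m*n/n≡m; +-distrib-/-∣ʳ; /-monoˡ-≤)
open import Data.Nat.Divisibility using (n∣m*n)
open import Data.Nat.Properties
open import Data.Nat.Tactic.RingSolver using (solve-∀)
open import Data.Product using (∃; _×_; _,_; proj₁; proj₂)
import Data.Product as Product
open import Data.Sum using (_⊎_; inj₁; inj₂; [_,_])
import Data.Sum as Sum
open import Data.Unit using (tt)
open import Function using (_∘_; id; flip; case_of_)
open import Function.Bundles using (Equivalence)
open import Relation.Binary using (DecidableEquality)
open import Relation.Binary.PropositionalEquality hiding ([_])
open import Relation.Nullary using (¬_; Dec; yes; no; ¬?)
open import Relation.Nullary.Decidable using (⌊_⌋; map′; _⊎-dec_; toWitness; decidable-stable)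

open import Defs

module _ {G : Graph} where

  Dist-unique : ∀ {u v k k′} → Dist G u v k → Dist G u v k′ → k ≡ k′
  Dist-unique (w , min) (w′ , min′) = ≤-antisym (min _ w′) (min′ _ w)

  Dist-intro : ∀ {u v} k → Walk G u v k → (∀ (j : Fin k) → ¬ Walk G u v (toℕ j)) → Dist G u v k
  Dist-intro {u} {v} k w shorter = w , minimal
    where
      minimal : ∀ j → Walk G u v j → k ≤ j
      minimal j wj with k ≤? j
      ... | yes k≤j = k≤j
      ... | no k≰j = ⊥-elim (shorter (fromℕ< (≰⇒> k≰j)) (subst (Walk G u v) (sym (toℕ-fromℕ< (≰⇒> k≰j))) wj))

  Dist-refl : ∀ {u} → Dist G u u 0
  Dist-refl = here , λ _ _ → z≤n

  Walk-snoc : ∀ {u v w k} → Walk G u v k → Adj G v w → Walk G u w (suc k)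
  Walk-snoc here a = step a here
  Walk-snoc (step b w) a = step b (Walk-snoc w a)

  Walk-reverse : (∀ {u v} → Adj G u v → Adj G v u) → ∀ {u v k} → Walk G u v k → Walk G v u k
  Walk-reverse sym-adj here = here
  Walk-reverse sym-adj (step a w) = Walk-snoc (Walk-reverse sym-adj w) (sym-adj a)

  Dist-sym : (∀ {u v} → Adj G u v → Adj G v u) → ∀ {u v k} → Dist G u v k → Dist G v u k
  Dist-sym sym-adj (w , min) = Walk-reverse sym-adj w , λ j w′ → min j (Walk-reverse sym-adj w′)

  Walk₀⇒≡ : ∀ {u v} → Walk G u v 0 → u ≡ v
  Walk₀⇒≡ here = refl

  Walk₁⇒Adj : ∀ {u v} → Walk G u v 1 → Adj G u v
  Walk₁⇒Adj (step a here) = a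

  Walk₂⇒Adj² : ∀ {u v} → Walk G u v 2 → ∃ λ w → Adj G u w × Adj G w v
  Walk₂⇒Adj² (step a (step b here)) = _ , a , b

LineGraph-Adj-sym : ∀ {m adj u w} → Adj (LineGraph m adj) u w → Adj (LineGraph m adj) w u
LineGraph-Adj-sym (u≢w , inj₁ eq) = u≢w ∘ sym , inj₁ (sym eq)
LineGraph-Adj-sym (u≢w , inj₂ (inj₁ eq)) = u≢w ∘ sym , inj₂ (inj₂ (inj₁ (sym eq)))
LineGraph-Adj-sym (u≢w , inj₂ (inj₂ (inj₁ eq))) = u≢w ∘ sym , inj₂ (inj₁ (sym eq))
LineGraph-Adj-sym (u≢w , inj₂ (inj₂ (inj₂ eq))) = u≢w ∘ sym , inj₂ (inj₂ (inj₂ (sym eq)))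

m≢2+m : ∀ m → m ≢ suc (suc m)
m≢2+m m eq = m≢1+m+n m (trans eq (cong suc (+-comm 1 m)))

next : ℕ → ℕ → ℕ
next n k with suc k ≟ n
... | yes _ = 0
... | no _  = suc k

module _ {n : ℕ} where

  next-suc : ∀ {k} → suc k < n → next n k ≡ suc k
  next-suc {k} k+1<n with suc k ≟ n
  ... | yes k+1≡n = ⊥-elim (<-irrefl k+1≡n k+1<n)
  ... | no _ = refl

  next-last : ∀ {k} → suc k ≡ n → next n k ≡ 0
  next-last {k} k+1≡n with suc k ≟ n
  ... | yes _ = refl
  ... | no k+1≢n = ⊥-elim (k+1≢n k+1≡n)

  next-cases : ∀ k → next n k ≡ suc k ⊎ next n k ≡ 0
  next-cases k with suc k ≟ n
  ... | yes _ = inj₂ refl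
  ... | no _ = inj₁ refl

  next-< : ∀ {k} → k < n → next n k < n
  next-< {k} k<n with suc k ≟ n
  ... | yes _ = ≤-trans (s≤s z≤n) k<n
  ... | no k+1≢n = ≤∧≢⇒< k<n k+1≢n

  next≡0⇒last : ∀ {k} → next n k ≡ 0 → suc k ≡ n
  next≡0⇒last {k} eq with suc k ≟ n
  ... | yes k+1≡n = k+1≡n
  next≡0⇒last {k} () | no _

  next-injective : ∀ {k l} → next n k ≡ next n l → k ≡ l
  next-injective {k} {l} eq with suc k ≟ n | suc l ≟ n
  ... | yes k+1≡n | yes l+1≡n = suc-injective (trans k+1≡n (sym l+1≡n))
  ... | no _ | no _ = suc-injective eq
  next-injective () | yes _ | no _
  next-injective () | no _ | yes _

  next-≢ : 2 ≤ n → ∀ k → next n k ≢ k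
  next-≢ 2≤n k eq with suc k ≟ n
  ... | yes k+1≡n = <-irrefl refl (≤-trans 2≤n (≤-reflexive (trans (sym k+1≡n) (cong suc (sym eq)))))
  ... | no _ = 1+n≢n eq

-- spoke i joins the hub to cycle vertex i; rim k joins cycle vertices k and k+1 (mod n).
data Edge : Set where
  spoke rim : ℕ → Edge

spoke≢rim : ∀ {i k} → spoke i ≢ rim k
spoke≢rim ()

spoke-injective : ∀ {i j} → spoke i ≡ spoke j → i ≡ j
spoke-injective refl = refl

rim-injective : ∀ {k l} → rim k ≡ rim l → k ≡ l
rim-injective refl = refl

label : Edge → ℕ
label (spoke i) = i
label (rim k) = k

Valid : ℕ → Edge → Set
Valid n e = label e < n

_≟ₑ_ : DecidableEquality Edge
spoke i ≟ₑ spoke j = map′ (cong spoke) spoke-injective (i ≟ j)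
spoke _ ≟ₑ rim _ = no λ ()
rim _ ≟ₑ spoke _ = no λ ()
rim k ≟ₑ rim l = map′ (cong rim) rim-injective (k ≟ l)

module _ (n : ℕ) where

  Incident : ℕ → ℕ → Set
  Incident i k = i ≡ k ⊎ i ≡ next n k

  Neighbours : ℕ → ℕ → Set
  Neighbours k l = l ≡ next n k ⊎ k ≡ next n l

  SecondNeighbours : ℕ → ℕ → Set
  SecondNeighbours k l = l ≡ next n (next n k) ⊎ k ≡ next n (next n l)

  -- Wheel vertices are numbered as in wheelAdj: the hub is 0 and cycle vertex i is suc i.
  Endpoint : Edge → ℕ → Set
  Endpoint (spoke i) x = x ≡ 0 ⊎ x ≡ suc i
  Endpoint (rim k) x = x ≡ suc k ⊎ x ≡ suc (next n k)

  Meets : Edge → Edge → Set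
  Meets e f = e ≢ f × ∃ λ x → Endpoint e x × Endpoint f x

  -- The distance in L(W_{1,n}) (see δ-Dist); rims far apart are joined through two spokes.
  δ : Edge → Edge → ℕ
  δ (spoke i) (spoke j) = if ⌊ i ≟ j ⌋ then 0 else 1
  δ (spoke i) (rim k) = if ⌊ i ≟ k ⌋ ∨ ⌊ i ≟ next n k ⌋ then 1 else 2
  δ (rim k) (spoke i) = δ (spoke i) (rim k)
  δ (rim k) (rim l) =
    if ⌊ k ≟ l ⌋ then 0 else
    if ⌊ l ≟ next n k ⌋ ∨ ⌊ k ≟ next n l ⌋ then 1 else
    if ⌊ l ≟ next n (next n k) ⌋ ∨ ⌊ k ≟ next n (next n l) ⌋ then 2 else 3

  data SpokeRimView (i k : ℕ) : ℕ → Set where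
    incident : Incident i k → SpokeRimView i k 1
    apart : ¬ Incident i k → SpokeRimView i k 2

  data RimRimView (k l : ℕ) : ℕ → Set where
    same : k ≡ l → RimRimView k l 0
    adjacent : k ≢ l → Neighbours k l → RimRimView k l 1
    twoApart : k ≢ l → ¬ Neighbours k l → SecondNeighbours k l → RimRimView k l 2
    farApart : k ≢ l → ¬ Neighbours k l → ¬ SecondNeighbours k l → RimRimView k l 3

module _ {n : ℕ} where

  Meets-sym : ∀ {e f} → Meets n e f → Meets n f e
  Meets-sym (e≢f , x , ex , fx) = e≢f ∘ sym , x , fx , ex

  spokes-meet : ∀ i j → i ≢ j → Meets n (spoke i) (spoke j)
  spokes-meet _ _ i≢j = (λ { refl → i≢j refl }) , 0 , inj₁ refl , inj₁ refl

  spoke-meets-rim : ∀ {i k} → Incident n i k → Meets n (spoke i) (rim k)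
  spoke-meets-rim (inj₁ i≡k) = (λ ()) , _ , inj₂ refl , inj₁ (cong suc i≡k)
  spoke-meets-rim (inj₂ i≡k′) = (λ ()) , _ , inj₂ refl , inj₂ (cong suc i≡k′)

  rims-meet : ∀ {k l} → k ≢ l → Neighbours n k l → Meets n (rim k) (rim l)
  rims-meet k≢l (inj₁ l≡k′) = (λ { refl → k≢l refl }) , _ , inj₂ refl , inj₁ (cong suc (sym l≡k′))
  rims-meet k≢l (inj₂ k≡l′) = (λ { refl → k≢l refl }) , _ , inj₁ refl , inj₂ (cong suc k≡l′)

  spoke-meets-rim⁻ : ∀ {i k} → Meets n (spoke i) (rim k) → Incident n i k
  spoke-meets-rim⁻ (_ , _ , inj₁ refl , inj₁ ())
  spoke-meets-rim⁻ (_ , _ , inj₁ refl , inj₂ ())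
  spoke-meets-rim⁻ (_ , _ , inj₂ refl , inj₁ eq) = inj₁ (suc-injective eq)
  spoke-meets-rim⁻ (_ , _ , inj₂ refl , inj₂ eq) = inj₂ (suc-injective eq)

  rims-meet⁻ : ∀ {k l} → Meets n (rim k) (rim l) → Neighbours n k l
  rims-meet⁻ (k≢l , _ , inj₁ refl , inj₁ eq) = ⊥-elim (k≢l (cong rim (suc-injective eq)))
  rims-meet⁻ (_ , _ , inj₁ refl , inj₂ eq) = inj₂ (suc-injective eq)
  rims-meet⁻ (_ , _ , inj₂ refl , inj₁ eq) = inj₁ (sym (suc-injective eq))
  rims-meet⁻ (k≢l , _ , inj₂ refl , inj₂ eq) = ⊥-elim (k≢l (cong rim (next-injective (suc-injective eq))))

  spokeRimView : ∀ i k → SpokeRimView n i k (δ n (spoke i) (rim k))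
  spokeRimView i k with i ≟ k | i ≟ next n k
  ... | yes i≡k | _ = incident (inj₁ i≡k)
  ... | no _ | yes i≡k′ = incident (inj₂ i≡k′)
  ... | no i≢k | no i≢k′ = apart [ i≢k , i≢k′ ]

  δ-spoke-rim : ∀ {i k d} → SpokeRimView n i k d → δ n (spoke i) (rim k) ≡ d
  δ-spoke-rim {i} {k} = unique (spokeRimView i k)
    where
      unique : ∀ {d d′} → SpokeRimView n i k d → SpokeRimView n i k d′ → d ≡ d′
      unique (incident _) (incident _) = refl
      unique (apart _) (apart _) = refl
      unique (incident p) (apart ¬p) = ⊥-elim (¬p p)
      unique (apart ¬p) (incident p) = ⊥-elim (¬p p)

  δ-spoke-rim⁻ : ∀ {i k d} → δ n (spoke i) (rim k) ≡ d → SpokeRimView n i k d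
  δ-spoke-rim⁻ {i} {k} eq = subst (SpokeRimView n i k) eq (spokeRimView i k)

  rimRimView : ∀ k l → RimRimView n k l (δ n (rim k) (rim l))
  rimRimView k l with k ≟ l | l ≟ next n k | k ≟ next n l
                   | l ≟ next n (next n k) | k ≟ next n (next n l)
  ... | yes k≡l | _ | _ | _ | _ = same k≡l
  ... | no k≢l | yes p | _ | _ | _ = adjacent k≢l (inj₁ p)
  ... | no k≢l | no ¬p | yes q | _ | _ = adjacent k≢l (inj₂ q)
  ... | no k≢l | no ¬p | no ¬q | yes r | _ = twoApart k≢l [ ¬p , ¬q ] (inj₁ r)
  ... | no k≢l | no ¬p | no ¬q | no ¬r | yes t = twoApart k≢l [ ¬p , ¬q ] (inj₂ t)
  ... | no k≢l | no ¬p | no ¬q | no ¬r | no ¬t = farApart k≢l [ ¬p , ¬q ] [ ¬r , ¬t ]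

  δ-rim-rim : ∀ {k l d} → RimRimView n k l d → δ n (rim k) (rim l) ≡ d
  δ-rim-rim {k} {l} = unique (rimRimView k l)
    where
      unique : ∀ {d d′} → RimRimView n k l d → RimRimView n k l d′ → d ≡ d′
      unique (same _) (same _) = refl
      unique (adjacent _ _) (adjacent _ _) = refl
      unique (twoApart _ _ _) (twoApart _ _ _) = refl
      unique (farApart _ _ _) (farApart _ _ _) = refl
      unique (same k≡l) (adjacent k≢l _) = ⊥-elim (k≢l k≡l)
      unique (same k≡l) (twoApart k≢l _ _) = ⊥-elim (k≢l k≡l)
      unique (same k≡l) (farApart k≢l _ _) = ⊥-elim (k≢l k≡l)
      unique (adjacent k≢l _) (same k≡l) = ⊥-elim (k≢l k≡l)
      unique (twoApart k≢l _ _) (same k≡l) = ⊥-elim (k≢l k≡l)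
      unique (farApart k≢l _ _) (same k≡l) = ⊥-elim (k≢l k≡l)
      unique (adjacent _ nb) (twoApart _ ¬nb _) = ⊥-elim (¬nb nb)
      unique (adjacent _ nb) (farApart _ ¬nb _) = ⊥-elim (¬nb nb)
      unique (twoApart _ ¬nb _) (adjacent _ nb) = ⊥-elim (¬nb nb)
      unique (farApart _ ¬nb _) (adjacent _ nb) = ⊥-elim (¬nb nb)
      unique (twoApart _ _ nb²) (farApart _ _ ¬nb²) = ⊥-elim (¬nb² nb²)
      unique (farApart _ _ ¬nb²) (twoApart _ _ nb²) = ⊥-elim (¬nb² nb²)

  δ-rim-rim⁻ : ∀ {k l d} → δ n (rim k) (rim l) ≡ d → RimRimView n k l d
  δ-rim-rim⁻ {k} {l} eq = subst (RimRimView n k l) eq (rimRimView k l)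

  δ-spokes-refl : ∀ i → δ n (spoke i) (spoke i) ≡ 0
  δ-spokes-refl i with i ≟ i
  ... | yes _ = refl
  ... | no i≢i = ⊥-elim (i≢i refl)

  δ-spokes≡0⇒ : ∀ {i j} → δ n (spoke i) (spoke j) ≡ 0 → i ≡ j
  δ-spokes≡0⇒ {i} {j} eq with i ≟ j
  ... | yes i≡j = i≡j
  δ-spokes≡0⇒ () | no _

  δ-rim-rim-sym : ∀ k l → δ n (rim k) (rim l) ≡ δ n (rim l) (rim k)
  δ-rim-rim-sym k l = sym (δ-rim-rim (swap (rimRimView k l)))
    where
      swap : ∀ {d} → RimRimView n k l d → RimRimView n l k d
      swap (same k≡l) = same (sym k≡l)
      swap (adjacent k≢l nb) = adjacent (k≢l ∘ sym) (Sum.swap nb)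
      swap (twoApart k≢l ¬nb nb²) = twoApart (k≢l ∘ sym) (¬nb ∘ Sum.swap) (Sum.swap nb²)
      swap (farApart k≢l ¬nb ¬nb²) = farApart (k≢l ∘ sym) (¬nb ∘ Sum.swap) (¬nb² ∘ Sum.swap)

CycleAdjacent : ℕ → ℕ → ℕ → Set
CycleAdjacent n a b = suc a ≡ b ⊎ suc b ≡ a ⊎ (suc a ≡ n × b ≡ 0) ⊎ (suc b ≡ n × a ≡ 0)

T-cycAdj⁻ : ∀ {n} a b → T (cycAdj n a b) → CycleAdjacent n a b
T-cycAdj⁻ {n} a b t with Equivalence.to T-∨ t
... | inj₁ t₁ = inj₁ (≡ᵇ⇒≡ (suc a) b t₁)
... | inj₂ t₂ with Equivalence.to T-∨ t₂
...   | inj₁ t₃ = inj₂ (inj₁ (≡ᵇ⇒≡ (suc b) a t₃))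
...   | inj₂ t₄ with Equivalence.to T-∨ t₄
...     | inj₁ t₅ = let (x , y) = Equivalence.to T-∧ t₅ in
                    inj₂ (inj₂ (inj₁ (≡ᵇ⇒≡ (suc a) n x , ≡ᵇ⇒≡ b 0 y)))
...     | inj₂ t₆ = let (x , y) = Equivalence.to T-∧ t₆ in
                    inj₂ (inj₂ (inj₂ (≡ᵇ⇒≡ (suc b) n x , ≡ᵇ⇒≡ a 0 y)))

T-cycAdj⁺ : ∀ {n} a b → CycleAdjacent n a b → T (cycAdj n a b)
T-cycAdj⁺ {n} a b adj = Equivalence.from T-∨ (Sum.map (≡⇒≡ᵇ (suc a) b) (λ adj′ →
  Equivalence.from T-∨ (Sum.map (≡⇒≡ᵇ (suc b) a) (λ adj″ →
  Equivalence.from T-∨ (Sum.map (both (suc a) b) (both (suc b) a) adj″)) adj′)) adj)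
  where
    both : ∀ x y → x ≡ n × y ≡ 0 → T ((x ≡ᵇ n) ∧ (y ≡ᵇ 0))
    both x y (x≡n , y≡0) = Equivalence.from T-∧ (≡⇒≡ᵇ x n x≡n , ≡⇒≡ᵇ y 0 y≡0)

rimBetween : ℕ → ℕ → Edge
rimBetween a b with suc a ≟ b
... | yes _ = rim a
... | no _ = rim b

rimBetween-consecutive : ∀ {a b} → suc a ≡ b → rimBetween a b ≡ rim a
rimBetween-consecutive {a} {b} a+1≡b with suc a ≟ b
... | yes _ = refl
... | no a+1≢b = ⊥-elim (a+1≢b a+1≡b)

rimBetween-wrap : ∀ {a b} → suc a ≢ b → rimBetween a b ≡ rim b
rimBetween-wrap {a} {b} a+1≢b with suc a ≟ b
... | yes a+1≡b = ⊥-elim (a+1≢b a+1≡b)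
... | no _ = refl

module _ {n : ℕ} (3≤n : 3 ≤ n) where

  private
    LW : Graph
    LW = LineWheel n

    node : ∀ {k} → k < n → Fin (suc n)
    node k<n = fsuc (fromℕ< k<n)

    toℕ-node : ∀ {k} (k<n : k < n) → toℕ (node k<n) ≡ suc k
    toℕ-node k<n = cong suc (toℕ-fromℕ< k<n)

    cycleEdge : ∀ {a b} (a<n : a < n) (b<n : b < n) → a < b → CycleAdjacent n a b → V LW
    cycleEdge {a} {b} a<n b<n a<b adj =
      (node a<n , node b<n) ,
      subst₂ _<_ (sym (toℕ-node a<n)) (sym (toℕ-node b<n)) (s≤s a<b) ,
      subst₂ (λ x y → T (cycAdj n x y)) (sym (toℕ-fromℕ< a<n)) (sym (toℕ-fromℕ< b<n)) (T-cycAdj⁺ a b adj)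

    0<n : 0 < n
    0<n = ≤-trans (s≤s z≤n) 3≤n

    last-positive : ∀ {k} → suc k ≡ n → 0 < k
    last-positive k+1≡n = ≤-trans (s≤s z≤n) (s≤s⁻¹ (subst (3 ≤_) (sym k+1≡n) 3≤n))

  end₁ end₂ : V LW → ℕ
  end₁ u = toℕ (proj₁ (proj₁ u))
  end₂ u = toℕ (proj₂ (proj₁ u))

  EndOf : V LW → ℕ → Set
  EndOf u x = x ≡ end₁ u ⊎ x ≡ end₂ u

  vertex-ext : ∀ {u w} → end₁ u ≡ end₁ w → end₂ u ≡ end₂ w → u ≡ w
  vertex-ext {(a , b) , a<b , t} {(c , d) , _} e₁ e₂
    with toℕ-injective {i = a} {j = c} e₁ | toℕ-injective {i = b} {j = d} e₂
  ... | refl | refl = cong ((a , b) ,_) (cong₂ _,_ (<-irrelevant _ _) (T-irrelevant _ _))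

  Adj-intro : ∀ {u w x} → u ≢ w → EndOf u x → EndOf w x → Adj LW u w
  Adj-intro u≢w (inj₁ x₁) (inj₁ y₁) = u≢w , inj₁ (toℕ-injective (trans (sym x₁) y₁))
  Adj-intro u≢w (inj₁ x₁) (inj₂ y₂) = u≢w , inj₂ (inj₁ (toℕ-injective (trans (sym x₁) y₂)))
  Adj-intro u≢w (inj₂ x₂) (inj₁ y₁) = u≢w , inj₂ (inj₂ (inj₁ (toℕ-injective (trans (sym x₂) y₁))))
  Adj-intro u≢w (inj₂ x₂) (inj₂ y₂) = u≢w , inj₂ (inj₂ (inj₂ (toℕ-injective (trans (sym x₂) y₂))))

  Adj-elim : ∀ {u w} → Adj LW u w → ∃ λ x → EndOf u x × EndOf w x
  Adj-elim {u} (_ , inj₁ eq) = end₁ u , inj₁ refl , inj₁ (cong toℕ eq)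
  Adj-elim {u} (_ , inj₂ (inj₁ eq)) = end₁ u , inj₁ refl , inj₂ (cong toℕ eq)
  Adj-elim {u} (_ , inj₂ (inj₂ (inj₁ eq))) = end₂ u , inj₂ refl , inj₁ (cong toℕ eq)
  Adj-elim {u} (_ , inj₂ (inj₂ (inj₂ eq))) = end₂ u , inj₂ refl , inj₂ (cong toℕ eq)

  toVertex : (e : Edge) → Valid n e → V LW
  toVertex (spoke i) i<n = (fzero , node i<n) , s≤s z≤n , tt
  toVertex (rim k) k<n with suc k ≟ n
  ... | no k+1≢n = cycleEdge k<n (≤∧≢⇒< k<n k+1≢n) ≤-refl (inj₁ refl)
  ... | yes k+1≡n = cycleEdge 0<n k<n (last-positive k+1≡n) (inj₂ (inj₂ (inj₂ (k+1≡n , refl))))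

  toVertex-cong : ∀ {a b} → a ≡ b → (p : Valid n a) (q : Valid n b) → toVertex a p ≡ toVertex b q
  toVertex-cong {a} refl p q = cong (toVertex a) (<-irrelevant p q)

  fromVertex : V LW → Edge
  fromVertex ((fzero , fzero) , () , _)
  fromVertex ((fzero , fsuc j) , _) = spoke (toℕ j)
  fromVertex ((fsuc i , fzero) , () , _)
  fromVertex ((fsuc i , fsuc j) , _) = rimBetween (toℕ i) (toℕ j)

  fromVertex-valid : ∀ u → Valid n (fromVertex u)
  fromVertex-valid ((fzero , fzero) , () , _)
  fromVertex-valid ((fzero , fsuc j) , _) = toℕ<n j
  fromVertex-valid ((fsuc i , fzero) , () , _)
  fromVertex-valid ((fsuc i , fsuc j) , _) with suc (toℕ i) ≟ toℕ j
  ... | yes _ = toℕ<n i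
  ... | no _ = toℕ<n j

  fromVertex-toVertex : ∀ e p → fromVertex (toVertex e p) ≡ e
  fromVertex-toVertex (spoke i) p = cong spoke (toℕ-fromℕ< p)
  fromVertex-toVertex (rim k) p with suc k ≟ n
  ... | no k+1≢n = trans (cong₂ rimBetween (toℕ-fromℕ< p) (toℕ-fromℕ< _)) (rimBetween-consecutive refl)
  ... | yes k+1≡n = trans (cong₂ rimBetween (toℕ-fromℕ< _) (toℕ-fromℕ< p)) (rimBetween-wrap 1≢k)
    where
      1≢k : 1 ≢ k
      1≢k refl = <⇒≱ 3≤n (≤-reflexive (sym k+1≡n))

  private
    wrap-around : ∀ {a b} → a < b → suc a ≢ b → CycleAdjacent n a b → suc b ≡ n × a ≡ 0
    wrap-around a<b a+1≢b (inj₁ a+1≡b) = ⊥-elim (a+1≢b a+1≡b)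
    wrap-around a<b a+1≢b (inj₂ (inj₁ refl)) = ⊥-elim (<-asym a<b ≤-refl)
    wrap-around () a+1≢b (inj₂ (inj₂ (inj₁ (_ , refl))))
    wrap-around a<b a+1≢b (inj₂ (inj₂ (inj₂ wrap))) = wrap

  toVertex-fromVertex : ∀ u → toVertex (fromVertex u) (fromVertex-valid u) ≡ u
  toVertex-fromVertex ((fzero , fzero) , () , _)
  toVertex-fromVertex ((fsuc i , fzero) , () , _)
  toVertex-fromVertex ((fzero , fsuc j) , _) = vertex-ext refl (toℕ-node (toℕ<n j))
  toVertex-fromVertex ((fsuc i , fsuc j) , i<j , t) with suc (toℕ i) ≟ toℕ j
  ... | yes i+1≡j with suc (toℕ i) ≟ n
  ...   | no i+1≢n = vertex-ext (toℕ-node (toℕ<n i)) (trans (toℕ-node (≤∧≢⇒< (toℕ<n i) i+1≢n)) (cong suc i+1≡j))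
  ...   | yes i+1≡n = ⊥-elim (<-irrefl (trans (sym i+1≡j) i+1≡n) (toℕ<n j))
  toVertex-fromVertex ((fsuc i , fsuc j) , i<j , t) | no i+1≢j
    with wrap-around (s≤s⁻¹ i<j) i+1≢j (T-cycAdj⁻ (toℕ i) (toℕ j) t)
  ... | j+1≡n , i≡0 with suc (toℕ j) ≟ n
  ...   | yes _ = vertex-ext (trans (toℕ-node 0<n) (cong suc (sym i≡0))) (toℕ-node (toℕ<n j))
  ...   | no j+1≢n = ⊥-elim (j+1≢n j+1≡n)

  fromVertex-injective : ∀ {u w} → fromVertex u ≡ fromVertex w → u ≡ w
  fromVertex-injective {u} {w} eq = begin
    u                                             ≡⟨ sym (toVertex-fromVertex u) ⟩
    toVertex (fromVertex u) (fromVertex-valid u) ≡⟨ toVertex-cong eq _ _ ⟩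
    toVertex (fromVertex w) (fromVertex-valid w) ≡⟨ toVertex-fromVertex w ⟩
    w                                             ∎
    where open ≡-Reasoning

  toVertex-injective : ∀ {a b} p q → toVertex a p ≡ toVertex b q → a ≡ b
  toVertex-injective {a} {b} p q eq =
    trans (sym (fromVertex-toVertex a p)) (trans (cong fromVertex eq) (fromVertex-toVertex b q))

  Endpoint⇒EndOf : ∀ e p {x} → Endpoint n e x → EndOf (toVertex e p) x
  Endpoint⇒EndOf (spoke i) p (inj₁ x≡0) = inj₁ x≡0
  Endpoint⇒EndOf (spoke i) p (inj₂ x≡i+1) = inj₂ (trans x≡i+1 (sym (toℕ-node p)))
  Endpoint⇒EndOf (rim k) p end with suc k ≟ n
  Endpoint⇒EndOf (rim k) p (inj₁ x≡k+1) | no _ = inj₁ (trans x≡k+1 (sym (toℕ-node p)))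
  Endpoint⇒EndOf (rim k) p (inj₂ x≡k+2) | no k+1≢n = inj₂ (trans x≡k+2 (sym (toℕ-node (≤∧≢⇒< p k+1≢n))))
  Endpoint⇒EndOf (rim k) p (inj₁ x≡k+1) | yes _ = inj₂ (trans x≡k+1 (sym (toℕ-node p)))
  Endpoint⇒EndOf (rim k) p (inj₂ x≡1) | yes _ = inj₁ (trans x≡1 (sym (toℕ-node 0<n)))

  EndOf⇒Endpoint : ∀ e p {x} → EndOf (toVertex e p) x → Endpoint n e x
  EndOf⇒Endpoint (spoke i) p (inj₁ x≡0) = inj₁ x≡0
  EndOf⇒Endpoint (spoke i) p (inj₂ x≡i+1) = inj₂ (trans x≡i+1 (toℕ-node p))
  EndOf⇒Endpoint (rim k) p end with suc k ≟ n
  EndOf⇒Endpoint (rim k) p (inj₁ x≡k+1) | no _ = inj₁ (trans x≡k+1 (toℕ-node p))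
  EndOf⇒Endpoint (rim k) p (inj₂ x≡k+2) | no k+1≢n = inj₂ (trans x≡k+2 (toℕ-node (≤∧≢⇒< p k+1≢n)))
  EndOf⇒Endpoint (rim k) p (inj₂ x≡k+1) | yes _ = inj₁ (trans x≡k+1 (toℕ-node p))
  EndOf⇒Endpoint (rim k) p (inj₁ x≡1) | yes _ = inj₂ (trans x≡1 (toℕ-node 0<n))

  Meets⇒Adj : ∀ {a b} p q → Meets n a b → Adj LW (toVertex a p) (toVertex b q)
  Meets⇒Adj {a} {b} p q (a≢b , x , xa , xb) =
    Adj-intro (a≢b ∘ toVertex-injective p q) (Endpoint⇒EndOf a p xa) (Endpoint⇒EndOf b q xb)

  Adj⇒Meets : ∀ {u w} → Adj LW u w → Meets n (fromVertex u) (fromVertex w)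
  Adj⇒Meets {u} {w} adj with Adj-elim adj
  ... | x , xu , xw = proj₁ adj ∘ fromVertex-injective , x , endpoint u xu , endpoint w xw
    where
      endpoint : ∀ v → EndOf v x → Endpoint n (fromVertex v) x
      endpoint v xv = EndOf⇒Endpoint (fromVertex v) (fromVertex-valid v)
                        (subst (λ v′ → EndOf v′ x) (sym (toVertex-fromVertex v)) xv)

data Route (n : ℕ) : Edge → Edge → ℕ → Set where
  stop : ∀ {a} → Route n a a 0
  go : ∀ {a c b k} → Meets n a c → Valid n c → Route n c b k → Route n a b (suc k)

module _ {n : ℕ} (3≤n : 3 ≤ n) where

  private
    LW : Graph
    LW = LineWheel n

    vert : (e : Edge) → Valid n e → V LW
    vert = toVertex 3≤n

  Route⇒Walk : ∀ {a b k} (p : Valid n a) (q : Valid n b) → Route n a b k → Walk LW (vert a p) (vert b q) k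
  Route⇒Walk {a} p q stop = subst (λ v → Walk LW (vert a p) v 0) (toVertex-cong 3≤n {a} refl p q) here
  Route⇒Walk p q (go m r route) = step (Meets⇒Adj 3≤n p r m) (Route⇒Walk r q route)

  Walk₀⇒≡ₑ : ∀ a b (p : Valid n a) (q : Valid n b) → Walk LW (vert a p) (vert b q) 0 → a ≡ b
  Walk₀⇒≡ₑ _ _ p q w = toVertex-injective 3≤n p q (Walk₀⇒≡ w)

  Walk₁⇒Meets : ∀ a b (p : Valid n a) (q : Valid n b) → Walk LW (vert a p) (vert b q) 1 → Meets n a b
  Walk₁⇒Meets a b p q w =
    subst₂ (Meets n) (fromVertex-toVertex 3≤n a p) (fromVertex-toVertex 3≤n b q) (Adj⇒Meets 3≤n (Walk₁⇒Adj w))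

  Walk₂⇒Meets² : ∀ a b (p : Valid n a) (q : Valid n b) → Walk LW (vert a p) (vert b q) 2 →
                  ∃ λ c → Meets n a c × Meets n c b
  Walk₂⇒Meets² a b p q w with Walk₂⇒Adj² w
  ... | v , adj₁ , adj₂ =
    fromVertex 3≤n v ,
    subst (λ e → Meets n e (fromVertex 3≤n v)) (fromVertex-toVertex 3≤n a p) (Adj⇒Meets 3≤n adj₁) ,
    subst (Meets n (fromVertex 3≤n v)) (fromVertex-toVertex 3≤n b q) (Adj⇒Meets 3≤n adj₂)

  private
    Dist-same : ∀ {a b} (p : Valid n a) (q : Valid n b) → a ≡ b → Dist LW (vert a p) (vert b q) 0
    Dist-same {a} p q refl = subst (λ v → Dist LW (vert a p) v 0) (toVertex-cong 3≤n {a} refl p q) Dist-refl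

  no-common-neighbour : ∀ {k l} → k ≢ l → ¬ Neighbours n k l → ¬ SecondNeighbours n k l →
                        ¬ (∃ λ c → Meets n (rim k) c × Meets n c (rim l))
  no-common-neighbour k≢l ¬nb ¬nb² (spoke i , m₁ , m₂)
    with spoke-meets-rim⁻ (Meets-sym m₁) | spoke-meets-rim⁻ m₂
  ... | inj₁ i≡k | inj₁ i≡l = k≢l (trans (sym i≡k) i≡l)
  ... | inj₁ i≡k | inj₂ i≡l′ = ¬nb (inj₂ (trans (sym i≡k) i≡l′))
  ... | inj₂ i≡k′ | inj₁ i≡l = ¬nb (inj₁ (trans (sym i≡l) i≡k′))
  ... | inj₂ i≡k′ | inj₂ i≡l′ = k≢l (next-injective (trans (sym i≡k′) i≡l′))
  no-common-neighbour k≢l ¬nb ¬nb² (rim m , m₁ , m₂) with rims-meet⁻ m₁ | rims-meet⁻ m₂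
  ... | inj₁ m≡k′ | inj₁ l≡m′ = ¬nb² (inj₁ (trans l≡m′ (cong (next n) m≡k′)))
  ... | inj₁ m≡k′ | inj₂ m≡l′ = k≢l (next-injective (trans (sym m≡k′) m≡l′))
  ... | inj₂ k≡m′ | inj₁ l≡m′ = k≢l (trans k≡m′ (sym l≡m′))
  ... | inj₂ k≡m′ | inj₂ m≡l′ = ¬nb² (inj₂ (trans k≡m′ (cong (next n) m≡l′)))

  spoke-rim-Dist : ∀ {i k d} (p : Valid n (spoke i)) (q : Valid n (rim k)) →
                   SpokeRimView n i k d → Dist LW (vert (spoke i) p) (vert (rim k) q) d
  spoke-rim-Dist {i} {k} p q (incident inc) =
    Dist-intro 1 (Route⇒Walk p q (go (spoke-meets-rim inc) q stop))
      λ { fzero w → spoke≢rim (Walk₀⇒≡ₑ (spoke i) (rim k) p q w) }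
  spoke-rim-Dist {i} {k} p q (apart ¬inc) =
    Dist-intro 2 (Route⇒Walk p q (go (spokes-meet {n} i k (¬inc ∘ inj₁)) q (go (spoke-meets-rim (inj₁ refl)) q stop)))
      λ { fzero w → spoke≢rim (Walk₀⇒≡ₑ (spoke i) (rim k) p q w)
        ; (fsuc fzero) w → ¬inc (spoke-meets-rim⁻ (Walk₁⇒Meets (spoke i) (rim k) p q w)) }

  rim-rim-Dist : ∀ {k l d} (p : Valid n (rim k)) (q : Valid n (rim l)) →
                 RimRimView n k l d → Dist LW (vert (rim k) p) (vert (rim l) q) d
  rim-rim-Dist p q (same k≡l) = Dist-same p q (cong rim k≡l)
  rim-rim-Dist {k} {l} p q (adjacent k≢l nb) =
    Dist-intro 1 (Route⇒Walk p q (go (rims-meet k≢l nb) q stop))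
      λ { fzero w → k≢l (rim-injective (Walk₀⇒≡ₑ (rim k) (rim l) p q w)) }
  rim-rim-Dist {k} {l} p q (twoApart k≢l ¬nb nb²) =
    Dist-intro 2 (Route⇒Walk p q (via nb²))
      λ { fzero w → k≢l (rim-injective (Walk₀⇒≡ₑ (rim k) (rim l) p q w))
        ; (fsuc fzero) w → ¬nb (rims-meet⁻ (Walk₁⇒Meets (rim k) (rim l) p q w)) }
    where
      2≤n : 2 ≤ n
      2≤n = ≤-trans (s≤s (s≤s z≤n)) 3≤n
      via : SecondNeighbours n k l → Route n (rim k) (rim l) 2
      via (inj₁ l≡k″) =
        go (rims-meet (next-≢ 2≤n k ∘ sym) (inj₁ refl)) (next-< p)
          (go (rims-meet (¬nb ∘ inj₁ ∘ sym) (inj₁ l≡k″)) q stop)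
      via (inj₂ k≡l″) =
        go (rims-meet (¬nb ∘ inj₂) (inj₂ k≡l″)) (next-< q)
          (go (rims-meet (next-≢ 2≤n l) (inj₂ refl)) q stop)
  rim-rim-Dist {k} {l} p q (farApart k≢l ¬nb ¬nb²) =
    Dist-intro 3 (Route⇒Walk p q
        (go (Meets-sym (spoke-meets-rim (inj₁ refl))) p
          (go (spokes-meet {n} k l k≢l) q
            (go (spoke-meets-rim (inj₁ refl)) q stop))))
      λ { fzero w → k≢l (rim-injective (Walk₀⇒≡ₑ (rim k) (rim l) p q w))
        ; (fsuc fzero) w → ¬nb (rims-meet⁻ (Walk₁⇒Meets (rim k) (rim l) p q w))
        ; (fsuc (fsuc fzero)) w → no-common-neighbour k≢l ¬nb ¬nb² (Walk₂⇒Meets² (rim k) (rim l) p q w) }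

  δ-Dist : ∀ a b (p : Valid n a) (q : Valid n b) → Dist LW (vert a p) (vert b q) (δ n a b)
  δ-Dist (spoke i) (spoke j) p q with i ≟ j
  ... | yes i≡j = Dist-same p q (cong spoke i≡j)
  ... | no i≢j = Dist-intro 1 (Route⇒Walk p q (go (spokes-meet {n} i j i≢j) q stop))
                   λ { fzero w → i≢j (spoke-injective (Walk₀⇒≡ₑ (spoke i) (spoke j) p q w)) }
  δ-Dist (spoke i) (rim k) p q = spoke-rim-Dist p q (spokeRimView i k)
  δ-Dist (rim k) (spoke i) p q = Dist-sym LineGraph-Adj-sym (spoke-rim-Dist q p (spokeRimView i k))
  δ-Dist (rim k) (rim l) p q = rim-rim-Dist p q (rimRimView k l)

Separates : ℕ → Edge → Edge → Edge → Set
Separates n a b y = δ n a y ≢ δ n b y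

Resolves : ℕ → List Edge → Set
Resolves n W = ∀ a b → Valid n a → Valid n b → a ≢ b → Any (Separates n a b) W

ResolvingSetOfSize : ℕ → ℕ → Set
ResolvingSetOfSize n k = ∃ λ W → All (Valid n) W × Resolves n W × length W ≡ k

module _ {n : ℕ} (3≤n : 3 ≤ n) where

  private
    LW : Graph
    LW = LineWheel n

    vert : (e : Edge) → Valid n e → V LW
    vert = toVertex 3≤n

    vertices : ∀ {W} → All (Valid n) W → List (V LW)
    vertices [] = []
    vertices {y ∷ _} (p ∷ ps) = vert y p ∷ vertices ps

    length-vertices : ∀ {W} (ps : All (Valid n) W) → length (vertices ps) ≡ length W
    length-vertices [] = refl
    length-vertices (_ ∷ ps) = cong suc (length-vertices ps)

    ∈-vertices : ∀ {W y} (ps : All (Valid n) W) (y∈W : y ∈ W) → vert y (All.lookup ps y∈W) ∈ vertices ps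
    ∈-vertices (_ ∷ _) (here refl) = here refl
    ∈-vertices (_ ∷ ps) (there y∈W) = there (∈-vertices ps y∈W)

    Dist-fromVertex : ∀ u b (q : Valid n b) → Dist LW u (vert b q) (δ n (fromVertex 3≤n u) b)
    Dist-fromVertex u b q =
      subst (λ w → Dist LW w (vert b q) (δ n (fromVertex 3≤n u) b)) (toVertex-fromVertex 3≤n u)
        (δ-Dist 3≤n (fromVertex 3≤n u) b (fromVertex-valid 3≤n u) q)

    Dist-toVertex : ∀ a (p : Valid n a) x → Dist LW (vert a p) x (δ n a (fromVertex 3≤n x))
    Dist-toVertex a p x =
      subst (λ w → Dist LW (vert a p) w (δ n a (fromVertex 3≤n x))) (toVertex-fromVertex 3≤n x)
        (δ-Dist 3≤n a (fromVertex 3≤n x) p (fromVertex-valid 3≤n x))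

    Resolving⇒Resolves : ∀ W → Resolving LW W → Resolves n (map (fromVertex 3≤n) W)
    Resolving⇒Resolves W R a b p q a≢b
      with R (vert a p) (vert b q) (a≢b ∘ toVertex-injective 3≤n p q)
    ... | x , x∈W , k₁ , k₂ , D₁ , D₂ , k₁≢k₂ =
      lose (∈-map⁺ (fromVertex 3≤n) x∈W) λ eq →
        k₁≢k₂ (trans (Dist-unique D₁ (Dist-toVertex a p x)) (trans eq (Dist-unique (Dist-toVertex b q x) D₂)))

    Resolves⇒Resolving : ∀ {W} (ps : All (Valid n) W) → Resolves n W → Resolving LW (vertices ps)
    Resolves⇒Resolving ps R u v u≢v
      with find (R (fromVertex 3≤n u) (fromVertex 3≤n v) (fromVertex-valid 3≤n u) (fromVertex-valid 3≤n v)
                   (u≢v ∘ fromVertex-injective 3≤n))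
    ... | y , y∈W , sep =
      vert y p , ∈-vertices ps y∈W , _ , _ , Dist-fromVertex u y p , Dist-fromVertex v y p , sep
      where
        p : Valid n y
        p = All.lookup ps y∈W

  LineWheel-MetricDim : ∀ k → ResolvingSetOfSize n k →
    (∀ W → All (Valid n) W → Resolves n W → k ≤ length W) →
    MetricDim (LineWheel n) k
  LineWheel-MetricDim k (W , ps , R , |W|≡k) lower-bound =
    (vertices ps , Resolves⇒Resolving ps R , trans (length-vertices ps) |W|≡k) ,
    λ W′ R′ → subst (k ≤_) (length-map (fromVertex 3≤n) W′)
                (lower-bound _ (All.map⁺ (All.universal (fromVertex-valid 3≤n) W′)) (Resolving⇒Resolves W′ R′))

edges : ℕ → List Edge
edges n = map spoke (upTo n) ++ map rim (upTo n)

module _ {n : ℕ} where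

  ∈-edges : ∀ {e} → Valid n e → e ∈ edges n
  ∈-edges {spoke i} p = ∈-++⁺ˡ (∈-map⁺ spoke (∈-upTo⁺ p))
  ∈-edges {rim k} p = ∈-++⁺ʳ (map spoke (upTo n)) (∈-map⁺ rim (∈-upTo⁺ p))

  edges-valid : All (Valid n) (edges n)
  edges-valid = All.++⁺ (All.map⁺ (All.tabulate ∈-upTo⁻)) (All.map⁺ (All.tabulate ∈-upTo⁻))

ResolvesAll : ℕ → List Edge → Set
ResolvesAll n W = All (λ a → All (λ b → a ≡ b ⊎ Any (Separates n a b) W) (edges n)) (edges n)

resolvesAll? : ∀ n W → Dec (ResolvesAll n W)
resolvesAll? n W =
  all? (λ a → all? (λ b → (a ≟ₑ b) ⊎-dec any? (λ y → ¬? (δ n a y ≟ δ n b y)) W) (edges n)) (edges n)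

module _ {n : ℕ} {W : List Edge} where

  ResolvesAll⇒Resolves : ResolvesAll n W → Resolves n W
  ResolvesAll⇒Resolves R a b p q a≢b = [ ⊥-elim ∘ a≢b , id ] (All.lookup (All.lookup R (∈-edges p)) (∈-edges q))

  Resolves⇒ResolvesAll : Resolves n W → ResolvesAll n W
  Resolves⇒ResolvesAll R = All.tabulate λ {a} a∈ → All.tabulate λ {b} b∈ → separate a b (valid a∈) (valid b∈)
    where
      valid : ∀ {e} → e ∈ edges n → Valid n e
      valid = All.lookup edges-valid
      separate : ∀ a b → Valid n a → Valid n b → a ≡ b ⊎ Any (Separates n a b) W
      separate a b p q with a ≟ₑ b
      ... | yes a≡b = inj₁ a≡b
      ... | no a≢b = inj₂ (R a b p q a≢b)

listsUpTo : ∀ {A : Set} → ℕ → List A → List (List A)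
listsUpTo zero xs = [] ∷ []
listsUpTo (suc m) xs = [] ∷ cartesianProductWith _∷_ xs (listsUpTo m xs)

∈-listsUpTo : ∀ {A : Set} {xs ys : List A} m → All (_∈ xs) ys → length ys ≤ m → ys ∈ listsUpTo m xs
∈-listsUpTo zero [] _ = here refl
∈-listsUpTo (suc m) [] _ = here refl
∈-listsUpTo (suc m) (y∈ ∷ ys∈) (s≤s |ys|≤m) =
  there (∈-cartesianProductWith⁺ _∷_ y∈ (∈-listsUpTo m ys∈ |ys|≤m))

module _ {n : ℕ} where

  lower-bound-by-computation : ∀ m → T ⌊ all? (λ W → ¬? (resolvesAll? n W)) (listsUpTo m (edges n)) ⌋ →
                               ∀ W → All (Valid n) W → Resolves n W → m < length W
  lower-bound-by-computation m none W ps R with m <? length W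
  ... | yes m<|W| = m<|W|
  ... | no m≮|W| =
    ⊥-elim (All.lookup (toWitness none) (∈-listsUpTo m (All.map ∈-edges ps) (≮⇒≥ m≮|W|)) (Resolves⇒ResolvesAll R))

  resolving-set-by-computation : ∀ W → T ⌊ all? (λ e → label e <? n) W ⌋ → T ⌊ resolvesAll? n W ⌋ →
                                 ResolvingSetOfSize n (length W)
  resolving-set-by-computation W valid resolves =
    W , toWitness valid , ResolvesAll⇒Resolves (toWitness resolves) , refl


∑< : ℕ → (ℕ → ℕ) → ℕ
∑< zero f = 0
∑< (suc n) f = ∑< n f + f n

syntax ∑< n (λ i → e) = ∑[ i < n ] e

∑-cong : ∀ n {f g} → (∀ i → i < n → f i ≡ g i) → ∑< n f ≡ ∑< n g
∑-cong zero eq = refl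
∑-cong (suc n) eq = cong₂ _+_ (∑-cong n (λ i i<n → eq i (m<n⇒m<1+n i<n))) (eq n ≤-refl)

∑-distrib-+ : ∀ n f g → ∑[ i < n ] (f i + g i) ≡ ∑< n f + ∑< n g
∑-distrib-+ zero f g = refl
∑-distrib-+ (suc n) f g = begin
  ∑[ i < n ] (f i + g i) + (f n + g n) ≡⟨ cong (_+ (f n + g n)) (∑-distrib-+ n f g) ⟩
  ∑< n f + ∑< n g + (f n + g n)        ≡⟨ +-+-swap (∑< n f) (∑< n g) (f n) (g n) ⟩
  ∑< n f + f n + (∑< n g + g n)        ∎
  where
    open ≡-Reasoning
    +-+-swap : ∀ a b c d → a + b + (c + d) ≡ a + c + (b + d)
    +-+-swap = solve-∀

∑-first : ∀ n f → ∑< (suc n) f ≡ f 0 + ∑[ i < n ] f (suc i)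
∑-first zero f = +-comm 0 (f 0)
∑-first (suc n) f = trans (cong (_+ f (suc n)) (∑-first n f)) (+-assoc (f 0) _ _)

∑-rotate : ∀ n f → 1 ≤ n → ∑[ i < n ] f (next n i) ≡ ∑< n f
∑-rotate (suc m) f _ = begin
  ∑[ i < m ] f (next (suc m) i) + f (next (suc m) m) ≡⟨ cong₂ _+_ (∑-cong m λ i i<m → cong f (next-suc (s≤s i<m)))
                                                                  (cong f (next-last refl)) ⟩
  ∑[ i < m ] f (suc i) + f 0                          ≡⟨ +-comm _ (f 0) ⟩
  f 0 + ∑[ i < m ] f (suc i)                          ≡⟨ sym (∑-first m f) ⟩
  ∑< (suc m) f                                        ∎
  where open ≡-Reasoning

∑-≥ : ∀ n m f → (∀ i → i < n → m ≤ f i) → n * m ≤ ∑< n f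
∑-≥ zero m f _ = z≤n
∑-≥ (suc n) m f m≤f = subst (_≤ ∑< n f + f n) (+-comm (n * m) m)
  (+-mono-≤ (∑-≥ n m f (λ i i<n → m≤f i (m<n⇒m<1+n i<n))) (m≤f n ≤-refl))

∑-zero : ∀ n f → (∀ i → i < n → f i ≡ 0) → ∑< n f ≡ 0
∑-zero n f f≡0 = trans (∑-cong n f≡0) (∑-of-zeros n)
  where
    ∑-of-zeros : ∀ n → ∑[ i < n ] 0 ≡ 0
    ∑-of-zeros zero = refl
    ∑-of-zeros (suc n) = trans (+-identityʳ _) (∑-of-zeros n)

indicator : ℕ → ℕ → ℕ
indicator i j = if ⌊ i ≟ j ⌋ then 1 else 0

∑-indicator : ∀ n j → j < n → ∑[ i < n ] indicator i j ≡ 1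
∑-indicator (suc n) j j<1+n with n ≟ j
... | yes refl = cong (_+ 1) (∑-zero n _ λ i i<n → off i (λ { refl → <-irrefl refl i<n }))
  where
    off : ∀ i → i ≢ n → indicator i n ≡ 0
    off i i≢n with i ≟ n
    ... | yes i≡n = ⊥-elim (i≢n i≡n)
    ... | no _ = refl
... | no n≢j = trans (+-identityʳ _) (∑-indicator n j (≤∧≢⇒< (s≤s⁻¹ j<1+n) (n≢j ∘ sym)))

∑-at-most-one : ∀ n f → (∀ i → f i ≤ 1) →
                (∀ i j → i < n → j < n → i ≢ j → f i ≡ 1 → f j ≡ 1 → ⊥) → ∑< n f ≤ 1
∑-at-most-one zero f _ _ = z≤n
∑-at-most-one (suc n) f f≤1 unique with f n in fn≡ | f≤1 n
... | 0 | _ = subst (_≤ 1) (sym (+-identityʳ _))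
                (∑-at-most-one n f f≤1 λ i j i<n j<n → unique i j (m<n⇒m<1+n i<n) (m<n⇒m<1+n j<n))
... | suc (suc _) | s≤s ()
... | 1 | _ = ≤-reflexive (cong (_+ 1) (∑-zero n f others))
  where
    others : ∀ i → i < n → f i ≡ 0
    others i i<n with f i in fi≡ | f≤1 i
    ... | 0 | _ = refl
    ... | 1 | _ = ⊥-elim (unique i n (m<n⇒m<1+n i<n) ≤-refl (λ { refl → <-irrefl refl i<n }) fi≡ fn≡)
    ... | suc (suc _) | s≤s ()

isZero : ℕ → ℕ
isZero zero = 1
isZero (suc _) = 0

weight : ℕ → ℕ
weight x = x + isZero x

weight-positive : ∀ x → 1 ≤ weight x
weight-positive zero = ≤-refl
weight-positive (suc x) = s≤s z≤n

weight-≥ : ∀ x → x ≤ weight x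
weight-≥ x = m≤m+n x (isZero x)

-- An uncovered cycle vertex is charged 1, 2 and 1 by the three windows containing it.
window-weight : ∀ a b d → (b ≡ 1 → 2 ≤ a ⊎ 2 ≤ d) → 4 ≤ weight a + (weight b + isZero b) + weight d
window-weight a zero d _ = +-mono-≤ (+-mono-≤ (weight-positive a) ≤-refl) (weight-positive d)
window-weight a 1 d heavy-neighbour with heavy-neighbour refl
... | inj₁ 2≤a = +-mono-≤ (+-monoˡ-≤ 1 (≤-trans 2≤a (weight-≥ a))) (weight-positive d)
... | inj₂ 2≤d = +-mono-≤ (+-monoˡ-≤ 1 (weight-positive a)) (≤-trans 2≤d (weight-≥ d))
window-weight a (suc (suc b)) d _ = +-mono-≤ (+-mono-≤ (weight-positive a) (s≤s (s≤s z≤n))) (weight-positive d)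

module _ (n : ℕ) where

  foot₁ foot₂ : Edge → ℕ
  foot₁ (spoke m) = m
  foot₁ (rim k) = k
  foot₂ (spoke m) = m
  foot₂ (rim k) = next n k

  Touches : Edge → ℕ → Set
  Touches y i = i ≡ foot₁ y ⊎ i ≡ foot₂ y

  -- Counting a spoke twice at its cycle vertex makes the total cover of every edge 2.
  cover : Edge → ℕ → ℕ
  cover y i = indicator i (foot₁ y) + indicator i (foot₂ y)

  coverage : List Edge → ℕ → ℕ
  coverage [] i = 0
  coverage (y ∷ W) i = cover y i + coverage W i

indicator-≡ : ∀ i → indicator i i ≡ 1
indicator-≡ i with i ≟ i
... | yes _ = refl
... | no i≢i = ⊥-elim (i≢i refl)

indicator-≢ : ∀ {i j} → i ≢ j → indicator i j ≡ 0
indicator-≢ {i} {j} i≢j with i ≟ j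
... | yes i≡j = ⊥-elim (i≢j i≡j)
... | no _ = refl

module _ {n : ℕ} where

  Touches? : ∀ y i → Dec (Touches n y i)
  Touches? y i = (i ≟ foot₁ n y) ⊎-dec (i ≟ foot₂ n y)

  Touches⇒cover : ∀ {i} y → Touches n y i → 1 ≤ cover n y i
  Touches⇒cover y (inj₁ refl) = ≤-trans (≤-reflexive (sym (indicator-≡ (foot₁ n y)))) (m≤m+n _ _)
  Touches⇒cover y (inj₂ refl) = ≤-trans (≤-reflexive (sym (indicator-≡ (foot₂ n y)))) (m≤n+m _ _)

  cover-spoke : ∀ {i} m → Touches n (spoke m) i → cover n (spoke m) i ≡ 2
  cover-spoke m (inj₁ refl) = cong₂ _+_ (indicator-≡ m) (indicator-≡ m)
  cover-spoke m (inj₂ refl) = cong₂ _+_ (indicator-≡ m) (indicator-≡ m)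

  ∑-cover : ∀ y → Valid n y → ∑[ i < n ] cover n y i ≡ 2
  ∑-cover y p = begin
    ∑[ i < n ] cover n y i
      ≡⟨ ∑-distrib-+ n _ _ ⟩
    ∑[ i < n ] indicator i (foot₁ n y) + ∑[ i < n ] indicator i (foot₂ n y)
      ≡⟨ cong₂ _+_ (∑-indicator n _ (foot₁-< y p)) (∑-indicator n _ (foot₂-< y p)) ⟩
    2 ∎
    where
      open ≡-Reasoning
      foot₁-< : ∀ y → Valid n y → foot₁ n y < n
      foot₁-< (spoke _) p = p
      foot₁-< (rim _) p = p
      foot₂-< : ∀ y → Valid n y → foot₂ n y < n
      foot₂-< (spoke _) p = p
      foot₂-< (rim _) p = next-< p

  ∑-coverage : ∀ {W} → All (Valid n) W → ∑[ i < n ] coverage n W i ≡ 2 * length W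
  ∑-coverage [] = ∑-zero n _ (λ _ _ → refl)
  ∑-coverage {y ∷ W} (p ∷ ps) = begin
    ∑[ i < n ] (cover n y i + coverage n W i)            ≡⟨ ∑-distrib-+ n _ _ ⟩
    ∑[ i < n ] cover n y i + ∑[ i < n ] coverage n W i   ≡⟨ cong₂ _+_ (∑-cover y p) (∑-coverage ps) ⟩
    2 + 2 * length W                                      ≡⟨ sym (*-suc 2 (length W)) ⟩
    2 * suc (length W)                                    ∎
    where open ≡-Reasoning

  coverage-∈ : ∀ {W y} i → y ∈ W → cover n y i ≤ coverage n W i
  coverage-∈ {y ∷ W} i (here refl) = m≤m+n _ _
  coverage-∈ {y′ ∷ W} i (there y∈W) = ≤-trans (coverage-∈ i y∈W) (m≤n+m _ _)

  coverage-pair : ∀ {W y y′} i → y ∈ W → y′ ∈ W → y ≢ y′ → cover n y i + cover n y′ i ≤ coverage n W i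
  coverage-pair i (here refl) (here refl) y≢y′ = ⊥-elim (y≢y′ refl)
  coverage-pair i (here refl) (there y′∈W) _ = +-monoʳ-≤ _ (coverage-∈ i y′∈W)
  coverage-pair {y′ ∷ W} {y} i (there y∈W) (here refl) _ =
    subst (_≤ cover n y′ i + coverage n W i) (+-comm (cover n y′ i) (cover n y i))
      (+-monoʳ-≤ (cover n y′ i) (coverage-∈ i y∈W))
  coverage-pair {z ∷ W} i (there y∈W) (there y′∈W) y≢y′ =
    ≤-trans (coverage-pair i y∈W y′∈W y≢y′) (m≤n+m _ (cover n z i))

  coverage⇒Touches : ∀ {W} i → 1 ≤ coverage n W i → ∃ λ y → y ∈ W × Touches n y i
  coverage⇒Touches {y ∷ W} i 1≤c with Touches? y i
  ... | yes touches = y , here refl , touches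
  ... | no ¬touches with coverage⇒Touches {W} i (subst (1 ≤_) (cong (_+ coverage n W i) cover≡0) 1≤c)
    where
      cover≡0 : cover n y i ≡ 0
      cover≡0 = cong₂ _+_ (indicator-≢ (¬touches ∘ inj₁)) (indicator-≢ (¬touches ∘ inj₂))
  ...   | y′ , y′∈W , touches = y′ , there y′∈W , touches

  δ-spokes-agree : ∀ {i j} y → (Touches n y i → Touches n y j) → (Touches n y j → Touches n y i) →
                   δ n (spoke i) y ≡ δ n (spoke j) y
  δ-spokes-agree {i} {j} (spoke m) i⇒j j⇒i with i ≟ m | j ≟ m
  ... | yes _ | yes _ = refl
  ... | no _ | no _ = refl
  ... | yes i≡m | no j≢m = ⊥-elim (j≢m (Sum.reduce (i⇒j (inj₁ i≡m))))
  ... | no i≢m | yes j≡m = ⊥-elim (i≢m (Sum.reduce (j⇒i (inj₁ j≡m))))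
  δ-spokes-agree {i} {j} (rim k) i⇒j j⇒i = agree (spokeRimView i k) (spokeRimView j k)
    where
      agree : ∀ {d d′} → SpokeRimView n i k d → SpokeRimView n j k d′ → d ≡ d′
      agree (incident _) (incident _) = refl
      agree (apart _) (apart _) = refl
      agree (incident i~k) (apart j≁k) = ⊥-elim (j≁k (i⇒j i~k))
      agree (apart i≁k) (incident j~k) = ⊥-elim (i≁k (j⇒i j~k))

  separates-spokes : ∀ {i j} y → Separates n (spoke i) (spoke j) y →
                     (Touches n y i × ¬ Touches n y j) ⊎ (Touches n y j × ¬ Touches n y i)
  separates-spokes {i} {j} y sep with Touches? y i | Touches? y j
  ... | yes ti | no ¬tj = inj₁ (ti , ¬tj)
  ... | no ¬ti | yes tj = inj₂ (tj , ¬ti)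
  ... | yes ti | yes tj = ⊥-elim (sep (δ-spokes-agree y (λ _ → tj) (λ _ → ti)))
  ... | no ¬ti | no ¬tj = ⊥-elim (sep (δ-spokes-agree y (⊥-elim ∘ ¬ti) (⊥-elim ∘ ¬tj)))

module _ {n : ℕ} (3≤n : 3 ≤ n) {W : List Edge} (ps : All (Valid n) W) (R : Resolves n W) where

  private
    c : ℕ → ℕ
    c = coverage n W

    spoke-separator : ∀ {i j} → i < n → j < n → i ≢ j →
                      ∃ λ y → y ∈ W × ((Touches n y i × ¬ Touches n y j) ⊎ (Touches n y j × ¬ Touches n y i))
    spoke-separator {i} {j} i<n j<n i≢j with find (R (spoke i) (spoke j) i<n j<n (i≢j ∘ spoke-injective))
    ... | y , y∈W , sep = y , y∈W , separates-spokes y sep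

    2≤n : 2 ≤ n
    2≤n = ≤-trans (s≤s (s≤s z≤n)) 3≤n

    covered : ∀ {y i} → y ∈ W → Touches n y i → 1 ≤ c i
    covered {y} y∈W touches = ≤-trans (Touches⇒cover y touches) (coverage-∈ _ y∈W)

  uncovered-unique : ∀ {i j} → i < n → j < n → i ≢ j → c i ≡ 0 → c j ≡ 0 → ⊥
  uncovered-unique i<n j<n i≢j cᵢ≡0 cⱼ≡0 with spoke-separator i<n j<n i≢j
  ... | y , y∈W , inj₁ (ti , _) = <⇒≱ (covered y∈W ti) (≤-reflexive cᵢ≡0)
  ... | y , y∈W , inj₂ (tj , _) = <⇒≱ (covered y∈W tj) (≤-reflexive cⱼ≡0)

  other-foot-heavy : ∀ {k i j} → rim k ∈ W → i < n → j < n → i ≢ j →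
                     Touches n (rim k) i → Touches n (rim k) j → c i ≡ 1 → 2 ≤ c j
  other-foot-heavy {k} {i} {j} k∈W i<n j<n i≢j ti tj cᵢ≡1 with spoke-separator i<n j<n i≢j
  ... | y , y∈W , inj₁ (tyi , ¬tyj) =
    ⊥-elim (<⇒≱ (≤-trans (+-mono-≤ (Touches⇒cover (rim k) ti) (Touches⇒cover y tyi))
                         (coverage-pair i k∈W y∈W λ { refl → ¬tyj tj }))
                (≤-reflexive cᵢ≡1))
  ... | y , y∈W , inj₂ (tyj , ¬tyi) =
    ≤-trans (+-mono-≤ (Touches⇒cover (rim k) tj) (Touches⇒cover y tyj))
            (coverage-pair j k∈W y∈W λ { refl → ¬tyi ti })

  singly-covered⇒heavy-neighbour : ∀ {i} → i < n → c (next n i) ≡ 1 → 2 ≤ c i ⊎ 2 ≤ c (next n (next n i))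
  singly-covered⇒heavy-neighbour {i} i<n c≡1 with coverage⇒Touches (next n i) (≤-reflexive (sym c≡1))
  ... | spoke m , m∈W , touches =
    ⊥-elim (<⇒≱ (≤-trans (≤-reflexive (sym (cover-spoke {n} m touches))) (coverage-∈ (next n i) m∈W))
                (≤-reflexive c≡1))
  ... | rim k , k∈W , inj₁ refl =
    inj₂ (other-foot-heavy k∈W (next-< i<n) (next-< (next-< i<n)) (next-≢ 2≤n _ ∘ sym) (inj₁ refl) (inj₂ refl) c≡1)
  ... | rim k , k∈W , inj₂ i′≡k′ with next-injective i′≡k′
  ...   | refl = inj₁ (other-foot-heavy k∈W (next-< i<n) i<n (next-≢ 2≤n i) (inj₂ refl) (inj₁ refl) c≡1)

  counting-bound : n * 4 ≤ 6 * length W + 4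
  counting-bound = begin
    n * 4                                ≤⟨ ∑-≥ n 4 window (λ i i<n →
                                              window-weight _ _ _ (singly-covered⇒heavy-neighbour i<n)) ⟩
    ∑< n window                          ≡⟨ ∑-window ⟩
    (C + Z) + ((C + Z) + Z) + (C + Z)    ≡⟨ rearrange C Z ⟩
    3 * C + 4 * Z                        ≤⟨ +-mono-≤ (≤-reflexive (cong (3 *_) (∑-coverage ps))) (*-monoʳ-≤ 4 Z≤1) ⟩
    3 * (2 * length W) + 4 * 1           ≡⟨ collect (length W) ⟩
    6 * length W + 4                     ∎
    where
      open ≤-Reasoning
      1≤n : 1 ≤ n
      1≤n = ≤-trans (s≤s z≤n) 3≤n

      w : ℕ → ℕ
      w i = weight (c i)

      window : ℕ → ℕ
      window i = w i + (w (next n i) + isZero (c (next n i))) + w (next n (next n i))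

      C Z : ℕ
      C = ∑< n c
      Z = ∑[ i < n ] isZero (c i)

      ∑-window : ∑< n window ≡ (C + Z) + ((C + Z) + Z) + (C + Z)
      ∑-window = begin-equality
        ∑< n window
          ≡⟨ ∑-distrib-+ n _ _ ⟩
        ∑[ i < n ] (w i + (w (next n i) + isZero (c (next n i)))) + ∑[ i < n ] w (next n (next n i))
          ≡⟨ cong₂ _+_ (∑-distrib-+ n _ _) (trans (∑-rotate n (w ∘ next n) 1≤n) (∑-rotate n w 1≤n)) ⟩
        ∑< n w + ∑[ i < n ] (w (next n i) + isZero (c (next n i))) + ∑< n w
          ≡⟨ cong (λ x → ∑< n w + x + ∑< n w) (∑-distrib-+ n _ _) ⟩
        ∑< n w + (∑[ i < n ] w (next n i) + ∑[ i < n ] isZero (c (next n i))) + ∑< n w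
          ≡⟨ cong (λ x → ∑< n w + x + ∑< n w) (cong₂ _+_ (∑-rotate n w 1≤n) (∑-rotate n (isZero ∘ c) 1≤n)) ⟩
        ∑< n w + (∑< n w + Z) + ∑< n w
          ≡⟨ cong (λ x → x + (x + Z) + x) (∑-distrib-+ n c (isZero ∘ c)) ⟩
        (C + Z) + ((C + Z) + Z) + (C + Z) ∎

      Z≤1 : Z ≤ 1
      Z≤1 = ∑-at-most-one n (isZero ∘ c) (λ i → isZero≤1 (c i))
              λ i j i<n j<n i≢j zᵢ zⱼ → uncovered-unique i<n j<n i≢j (isZero≡1 (c i) zᵢ) (isZero≡1 (c j) zⱼ)
        where
          isZero≤1 : ∀ x → isZero x ≤ 1
          isZero≤1 zero = ≤-refl
          isZero≤1 (suc x) = z≤n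
          isZero≡1 : ∀ x → isZero x ≡ 1 → x ≡ 0
          isZero≡1 zero _ = refl
          isZero≡1 (suc x) ()

      rearrange : ∀ C Z → (C + Z) + ((C + Z) + Z) + (C + Z) ≡ 3 * C + 4 * Z
      rearrange = solve-∀

      collect : ∀ L → 3 * (2 * L) + 4 * 1 ≡ 6 * L + 4
      collect = solve-∀

record Agree (n : ℕ) (W : List Edge) (a b : Edge) : Set where
  constructor agreeing
  field at : ∀ {y} → y ∈ W → δ n a y ≡ δ n b y
open Agree

Resolves-intro : ∀ {n W} → (∀ a b → Valid n a → Valid n b → Agree n W a b → a ≡ b) → Resolves n W
Resolves-intro {n} {W} determined a b p q a≢b with any? (λ y → ¬? (δ n a y ≟ δ n b y)) W
... | yes separated = separated
... | no ¬separated =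
  ⊥-elim (a≢b (determined a b p q (agreeing λ {y} y∈W →
    decidable-stable (δ n a y ≟ δ n b y) (¬separated ∘ lose y∈W))))

module _ {n : ℕ} where

  δ-rims-next : ∀ {k} → suc k < n → δ n (rim k) (rim (suc k)) ≡ 1
  δ-rims-next k+1<n = δ-rim-rim (adjacent (1+n≢n ∘ sym) (inj₁ (sym (next-suc k+1<n))))

  δ-rims-two : ∀ {k} → 4 ≤ n → suc (suc k) < n → δ n (rim k) (rim (suc (suc k))) ≡ 2
  δ-rims-two {k} 4≤n k+2<n = δ-rim-rim (twoApart (m≢2+m k) ¬neighbours (inj₁ (sym k″≡k+2)))
    where
      k′≡k+1 : next n k ≡ suc k
      k′≡k+1 = next-suc (<-trans (n<1+n _) k+2<n)
      k″≡k+2 : next n (next n k) ≡ suc (suc k)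
      k″≡k+2 = trans (cong (next n) k′≡k+1) (next-suc k+2<n)
      ¬neighbours : ¬ Neighbours n k (suc (suc k))
      ¬neighbours (inj₁ eq) = 1+n≢n (trans eq k′≡k+1)
      ¬neighbours (inj₂ eq) with next-cases {n} (suc (suc k))
      ... | inj₁ e = m≢1+m+n k (trans eq (trans e (cong suc (+-comm 2 k))))
      ... | inj₂ e = <⇒≱ 4≤n (≤-reflexive (trans (sym (next≡0⇒last e)) (cong (suc ∘ suc ∘ suc) (trans eq e))))

  δ-rims-far : ∀ k e → k + 3 + e < n → 6 + e ≤ n → δ n (rim k) (rim (k + 3 + e)) ≡ 3
  δ-rims-far k e l<n 6+e≤n = δ-rim-rim (farApart (<⇒≢ k<l) ¬neighbours ¬second)
    where
      l : ℕ
      l = k + 3 + e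
      k<l : k < l
      k<l = ≤-trans (m<m+n k (s≤s z≤n)) (m≤m+n (k + 3) e)
      k+2<l : suc (suc k) < l
      k+2<l = ≤-trans (≤-reflexive (+-comm 3 k)) (m≤m+n (k + 3) e)
      k′≡k+1 : next n k ≡ suc k
      k′≡k+1 = next-suc (<-trans (<-trans (n<1+n _) k+2<l) l<n)
      k″≡k+2 : next n (next n k) ≡ suc (suc k)
      k″≡k+2 = trans (cong (next n) k′≡k+1) (next-suc (<-trans k+2<l l<n))
      too-short : ¬ (n ≤ 5 + e)
      too-short = <⇒≱ 6+e≤n
      ¬neighbours : ¬ Neighbours n k l
      ¬neighbours (inj₁ l≡k′) = <⇒≢ (<-trans (n<1+n _) k+2<l) (sym (trans l≡k′ k′≡k+1))
      ¬neighbours (inj₂ k≡l′) with next-cases {n} l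
      ... | inj₁ e′ = <⇒≢ (<-trans k<l (n<1+n l)) (trans k≡l′ e′)
      ... | inj₂ e′ with trans k≡l′ e′
      ...   | refl = too-short (≤-trans (≤-reflexive (sym (next≡0⇒last e′))) (n≤1+n _))
      ¬second : ¬ SecondNeighbours n k l
      ¬second (inj₁ l≡k″) = <⇒≢ k+2<l (sym (trans l≡k″ k″≡k+2))
      ¬second (inj₂ k≡l″) with next-cases {n} l | next-cases {n} (next n l)
      ... | inj₁ e₁ | inj₁ e₂ =
        <⇒≢ (<-trans k<l (<-trans (n<1+n l) (n<1+n (suc l)))) (trans k≡l″ (trans e₂ (cong suc e₁)))
      ... | inj₂ e₁ | inj₁ e₂ with trans k≡l″ (trans e₂ (cong suc e₁))
      ...   | refl = too-short (≤-reflexive (sym (next≡0⇒last e₁)))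
      ¬second (inj₂ k≡l″) | inj₁ e₁ | inj₂ e₂ with trans k≡l″ e₂
      ...   | refl = too-short (≤-reflexive (trans (sym (next≡0⇒last e₂)) (cong suc e₁)))
      ¬second (inj₂ k≡l″) | inj₂ e₁ | inj₂ e₂ =
        <⇒≱ (≤-trans (s≤s (s≤s z≤n)) 6+e≤n) (≤-reflexive (trans (sym (next≡0⇒last e₂)) (cong suc e₁)))

blockRims : ℕ → List Edge
blockRims zero = []
blockRims (suc t) = rim (t * 3) ∷ rim (suc (t * 3)) ∷ blockRims t

tailSpoke : ℕ → ℕ → List Edge
tailSpoke 2 q = spoke (q * 3) ∷ []
tailSpoke _ q = []

landmarks : ℕ → ℕ → List Edge
landmarks q r = blockRims q ++ tailSpoke r q

length-landmarks : ∀ q r → length (landmarks q r) ≡ q * 2 + length (tailSpoke r q)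
length-landmarks q r = trans (length-++ (blockRims q)) (cong (_+ length (tailSpoke r q)) (length-blockRims q))
  where
    length-blockRims : ∀ q → length (blockRims q) ≡ q * 2
    length-blockRims zero = refl
    length-blockRims (suc q) = cong (suc ∘ suc) (length-blockRims q)

∈-blockRims : ∀ {t q} → t < q → rim (t * 3) ∈ blockRims q × rim (suc (t * 3)) ∈ blockRims q
∈-blockRims {t} {suc q} t<1+q with m≤n⇒m<n∨m≡n (s≤s⁻¹ t<1+q)
... | inj₁ t<q = Product.map (there ∘ there) (there ∘ there) (∈-blockRims t<q)
... | inj₂ refl = here refl , there (here refl)

blockRims-valid : ∀ {n} q → q * 3 ≤ n → All (Valid n) (blockRims q)
blockRims-valid zero _ = []
blockRims-valid {n} (suc q) 3+3q≤n =
  ≤-trans (s≤s (m≤n+m _ 2)) 3+3q≤n ∷ ≤-trans (s≤s (s≤s (m≤n+m _ 1))) 3+3q≤n ∷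
  blockRims-valid q (≤-trans (m≤n+m _ 3) 3+3q≤n)

landmarks-valid : ∀ q r → r ≤ 2 → All (Valid (r + q * 3)) (landmarks q r)
landmarks-valid q r r≤2 = All.++⁺ (blockRims-valid q (m≤n+m _ r)) (tail-valid r r≤2)
  where
    tail-valid : ∀ r → r ≤ 2 → All (Valid (r + q * 3)) (tailSpoke r q)
    tail-valid 0 _ = []
    tail-valid 1 _ = []
    tail-valid 2 _ = s≤s (m≤n+m _ 1) ∷ []
    tail-valid (suc (suc (suc _))) (s≤s (s≤s ()))

data Position (q r i : ℕ) : Set where
  block : ∀ t e → t < q → e < 3 → i ≡ e + t * 3 → Position q r i
  tail : ∀ e → e < r → i ≡ e + q * 3 → Position q r i

position : ∀ q r → r ≤ 2 → ∀ {i} → i < r + q * 3 → Position q r i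
position q r r≤2 {i} i<n with i / 3 <? q
... | yes t<q = block (i / 3) (i % 3) t<q (m%n<n i 3) (m≡m%n+[m/n]*n i 3)
... | no t≮q = tail (i % 3) (+-cancelʳ-< (q * 3) (i % 3) r (subst (_< r + q * 3) i≡ i<n)) i≡
  where
    t≤q : i / 3 ≤ q
    t≤q = s≤s⁻¹ (m<n*o⇒m/o<n {n = suc q} (≤-trans i<n (+-monoˡ-≤ (q * 3) (m≤n⇒m≤1+n r≤2))))
    i≡ : i ≡ i % 3 + q * 3
    i≡ = trans (m≡m%n+[m/n]*n i 3) (cong (λ t → i % 3 + t * 3) (≤-antisym t≤q (≮⇒≥ t≮q)))

module _ {n : ℕ} {W : List Edge} where

  Agree-sym : ∀ {a b} → Agree n W a b → Agree n W b a
  Agree-sym agree = agreeing λ y∈W → sym (at agree y∈W)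

  spoke-landmark : ∀ {i j m} → Agree n W (spoke i) (spoke j) → spoke m ∈ W → i ≡ m → j ≡ m
  spoke-landmark {i} agree m∈W refl = δ-spokes≡0⇒ {n} (trans (sym (at agree m∈W)) (δ-spokes-refl {n} i))

  rim-landmark : ∀ {k l m} → Agree n W (rim k) (rim l) → rim m ∈ W → k ≡ m → l ≡ m
  rim-landmark {k} {l} agree m∈W refl with δ-rim-rim⁻ (trans (sym (at agree m∈W)) (δ-rim-rim {n} {k} {k} (same refl)))
  ... | same l≡k = l≡k

  incident-transfer : ∀ {i j k} → Agree n W (spoke i) (spoke j) → rim k ∈ W → Incident n i k → Incident n j k
  incident-transfer agree k∈W i~k with δ-spoke-rim⁻ (trans (sym (at agree k∈W)) (δ-spoke-rim (incident i~k)))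
  ... | incident j~k = j~k

  apart-transfer : ∀ {i j k} → Agree n W (spoke i) (spoke j) → rim k ∈ W → ¬ Incident n i k → ¬ Incident n j k
  apart-transfer agree k∈W i≁k j~k = i≁k (incident-transfer (Agree-sym agree) k∈W j~k)

  spoke-rim-landmark : ∀ {i l m} → Agree n W (spoke i) (rim l) → rim m ∈ W →
                       δ n (rim l) (rim m) ≡ 0 ⊎ δ n (rim l) (rim m) ≡ 3 → ⊥
  spoke-rim-landmark {i} {l} {m} agree m∈W far =
    neither-0-nor-3 (spokeRimView i m) (Sum.map (trans (at agree m∈W)) (trans (at agree m∈W)) far)
    where
      neither-0-nor-3 : ∀ {d} → SpokeRimView n i m d → d ≡ 0 ⊎ d ≡ 3 → ⊥
      neither-0-nor-3 (incident _) (inj₁ ())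
      neither-0-nor-3 (incident _) (inj₂ ())
      neither-0-nor-3 (apart _) (inj₁ ())
      neither-0-nor-3 (apart _) (inj₂ ())

module _ (q₀ r : ℕ) (r≤2 : r ≤ 2) where

  private
    q P n : ℕ
    q = 3 + q₀
    P = 2 + q₀
    n = r + q * 3

    W : List Edge
    W = landmarks q r

    q*3≤n : q * 3 ≤ n
    q*3≤n = m≤n+m (q * 3) r

    9≤n : 9 ≤ n
    9≤n = ≤-trans (m≤m+n 9 (q₀ * 3)) q*3≤n

    block-fits : ∀ {t} → t < q → 3 + t * 3 ≤ n
    block-fits t<q = ≤-trans (*-monoˡ-≤ 3 t<q) q*3≤n

    next-block₀ : ∀ {t} → t < q → next n (t * 3) ≡ suc (t * 3)
    next-block₀ t<q = next-suc (≤-trans (s≤s (s≤s (m≤n+m _ 1))) (block-fits t<q))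

    next-block₁ : ∀ {t} → t < q → next n (suc (t * 3)) ≡ suc (suc (t * 3))
    next-block₁ t<q = next-suc (block-fits t<q)

    rim-landmarks : ∀ {t} → t < q → rim (t * 3) ∈ W × rim (suc (t * 3)) ∈ W
    rim-landmarks t<q = Product.map ∈-++⁺ˡ ∈-++⁺ˡ (∈-blockRims t<q)

    tail-landmark : r ≡ 2 → spoke (q * 3) ∈ W
    tail-landmark r≡2 = subst (λ r → spoke (q * 3) ∈ landmarks q r) (sym r≡2) (∈-++⁺ʳ (blockRims q) (here refl))

    spokes-in-block : ∀ {t e j} → t < q → e < 3 → Agree n W (spoke (e + t * 3)) (spoke j) → j ≡ e + t * 3
    spokes-in-block {t} {0} {j} t<q _ agree with incident-transfer agree (proj₁ (rim-landmarks t<q)) (inj₁ refl)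
    ... | inj₁ j≡a = j≡a
    ... | inj₂ j≡a′ =
      ⊥-elim (apart-transfer agree (proj₂ (rim-landmarks t<q)) a≁a+1 (inj₁ (trans j≡a′ (next-block₀ t<q))))
      where
        a≁a+1 : ¬ Incident n (t * 3) (suc (t * 3))
        a≁a+1 = [ 1+n≢n ∘ sym , m≢2+m _ ∘ flip trans (next-block₁ t<q) ]
    spokes-in-block {t} {1} {j} t<q _ agree
      with incident-transfer agree (proj₁ (rim-landmarks t<q)) (inj₂ (sym (next-block₀ t<q)))
    ... | inj₂ j≡a′ = trans j≡a′ (next-block₀ t<q)
    ... | inj₁ refl with incident-transfer agree (proj₂ (rim-landmarks t<q)) (inj₁ refl)
    ...   | inj₁ a≡a+1 = ⊥-elim (1+n≢n (sym a≡a+1))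
    ...   | inj₂ a≡a″ = ⊥-elim (m≢2+m _ (trans a≡a″ (next-block₁ t<q)))
    spokes-in-block {t} {2} {j} t<q _ agree
      with incident-transfer agree (proj₂ (rim-landmarks t<q)) (inj₂ (sym (next-block₁ t<q)))
    ... | inj₂ j≡a″ = trans j≡a″ (next-block₁ t<q)
    ... | inj₁ j≡a+1 =
      ⊥-elim (apart-transfer agree (proj₁ (rim-landmarks t<q)) a+2≁a (inj₂ (trans j≡a+1 (sym (next-block₀ t<q)))))
      where
        a+2≁a : ¬ Incident n (suc (suc (t * 3))) (t * 3)
        a+2≁a = [ m≢2+m _ ∘ sym , 1+n≢n ∘ flip trans (next-block₀ t<q) ]
    spokes-in-block {e = suc (suc (suc _))} _ (s≤s (s≤s (s≤s ()))) _

    spokes-in-tail : ∀ {e e′} → e < r → e′ < r → Agree n W (spoke (e + q * 3)) (spoke (e′ + q * 3)) → e ≡ e′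
    spokes-in-tail {0} {0} _ _ _ = refl
    spokes-in-tail {1} {1} _ _ _ = refl
    spokes-in-tail {0} {1} _ 1<r agree =
      ⊥-elim (1+n≢n (spoke-landmark agree (tail-landmark (≤-antisym r≤2 1<r)) refl))
    spokes-in-tail {1} {0} 1<r _ agree =
      ⊥-elim (1+n≢n (spoke-landmark (Agree-sym agree) (tail-landmark (≤-antisym r≤2 1<r)) refl))
    spokes-in-tail {suc (suc _)} e<r _ _ = ⊥-elim (<⇒≱ e<r (≤-trans r≤2 (s≤s (s≤s z≤n))))
    spokes-in-tail {_} {suc (suc _)} _ e′<r _ = ⊥-elim (<⇒≱ e′<r (≤-trans r≤2 (s≤s (s≤s z≤n))))

    spokes-determined : ∀ {i j} → i < n → j < n → Agree n W (spoke i) (spoke j) → i ≡ j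
    spokes-determined i<n j<n agree with position q r r≤2 i<n
    ... | block t e t<q e<3 refl = sym (spokes-in-block t<q e<3 agree)
    ... | tail e e<r refl with position q r r≤2 j<n
    ...   | block t e′ t<q e′<3 refl = spokes-in-block t<q e′<3 (Agree-sym agree)
    ...   | tail e′ e′<r refl = cong (_+ q * 3) (spokes-in-tail e<r e′<r agree)

    0<q : 0 < q
    0<q = s≤s z≤n
    1<q : 1 < q
    1<q = s≤s (s≤s z≤n)
    2<q : 2 < q
    2<q = s≤s (s≤s (s≤s z≤n))

    at-most-9 : ∀ m → T (m ≤ᵇ 9) → m ≤ n
    at-most-9 m m≤9 = ≤-trans (≤ᵇ⇒≤ m 9 m≤9) 9≤n

    far-from-0 : ∀ {i} e → 3 + e < n → 6 + e ≤ n → Agree n W (spoke i) (rim (3 + e)) → ⊥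
    far-from-0 e l<n 6+e≤n agree =
      spoke-rim-landmark agree (proj₁ (rim-landmarks {0} 0<q))
        (inj₂ (trans (δ-rim-rim-sym {n} (3 + e) 0) (δ-rims-far {n} 0 e l<n 6+e≤n)))

    -- A spoke is at distance 1 or 2 from every rim, while each rim is at distance 0 or 3 from
    -- one of the landmarks rim 0, rim 1, rim 3, rim 6.
    spoke-rim-distinguished : ∀ {i l} → l < n → Agree n W (spoke i) (rim l) → ⊥
    spoke-rim-distinguished {l = 0} _ agree =
      spoke-rim-landmark agree (proj₁ (rim-landmarks {0} 0<q)) (inj₁ (δ-rim-rim {n} {0} {0} (same refl)))
    spoke-rim-distinguished {l = 1} _ agree =
      spoke-rim-landmark agree (proj₂ (rim-landmarks {0} 0<q)) (inj₁ (δ-rim-rim {n} {1} {1} (same refl)))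
    spoke-rim-distinguished {l = 2} _ agree =
      spoke-rim-landmark agree (proj₁ (rim-landmarks {2} 2<q)) (inj₂ (δ-rims-far {n} 2 1 (at-most-9 7 _) (at-most-9 7 _)))
    spoke-rim-distinguished {l = 3} _ agree = far-from-0 0 (at-most-9 4 _) (at-most-9 6 _) agree
    spoke-rim-distinguished {l = 4} _ agree = far-from-0 1 (at-most-9 5 _) (at-most-9 7 _) agree
    spoke-rim-distinguished {l = 5} _ agree = far-from-0 2 (at-most-9 6 _) (at-most-9 8 _) agree
    spoke-rim-distinguished {l = suc (suc (suc (suc (suc (suc l′)))))} l<n agree =
      spoke-rim-landmark agree (proj₁ (rim-landmarks {1} 1<q))
        (inj₂ (trans (δ-rim-rim-sym {n} (6 + l′) 3) (δ-rims-far {n} 3 l′ l<n (<⇒≤ l<n))))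

    tail-not-last : ∀ {e} → e < r → suc e ≢ r → e ≡ 0 × r ≡ 2
    tail-not-last {0} 0<r 1≢r = refl , ≤-antisym r≤2 (≤∧≢⇒< 0<r 1≢r)
    tail-not-last {suc e} e+1<r e+2≢r = ⊥-elim (e+2≢r (≤-antisym e+1<r (≤-trans r≤2 (s≤s (s≤s z≤n)))))

    -- If rim k is the last rim it is pinned down by rim 0 and rim 1; otherwise n ≡ 2 (mod 3),
    -- k = 3q, and it is pinned down by the tail spoke and rim (3q − 2).
    rims-in-tail : ∀ {e l} → e < r → l < n → Agree n W (rim (e + q * 3)) (rim l) → e + q * 3 ≡ l
    rims-in-tail {e} {l} e<r l<n agree with suc (e + q * 3) ≟ n
    ... | yes last with δ-rim-rim⁻ (trans (sym (at agree (proj₁ (rim-landmarks {0} 0<q)))) to-0)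
      where
        to-0 : δ n (rim (e + q * 3)) (rim 0) ≡ 1
        to-0 = δ-rim-rim (adjacent (<⇒≢ (≤-trans (s≤s z≤n) (m≤n+m (q * 3) e)) ∘ sym) (inj₁ (sym (next-last last))))
    ...   | adjacent _ (inj₁ 0≡l′) = suc-injective (trans last (sym (next≡0⇒last (sym 0≡l′))))
    ...   | adjacent _ (inj₂ l≡1) =
      ⊥-elim (<⇒≢ (≤-trans (s≤s (s≤s z≤n)) (m≤n+m (q * 3) e))
               (sym (rim-landmark (Agree-sym agree) (proj₂ (rim-landmarks {0} 0<q)) (trans l≡1 (next-suc (at-most-9 2 _))))))
    rims-in-tail {e} {l} e<r l<n agree | no ¬last with tail-not-last e<r (¬last ∘ cong (_+ q * 3))
    ... | refl , r≡2 with at agree (tail-landmark r≡2)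
    ...   | eq with δ-spoke-rim⁻ (trans (sym eq) (δ-spoke-rim {n} {q * 3} {q * 3} (incident (inj₁ refl))))
    ...     | incident (inj₁ q*3≡l) = q*3≡l
    ...     | incident (inj₂ q*3≡l′) with next-cases {n} l
    ...       | inj₂ l′≡0 = ⊥-elim (case trans q*3≡l′ l′≡0 of λ ())
    ...       | inj₁ l′≡l+1 with suc-injective (trans q*3≡l′ l′≡l+1)
    ...         | refl =
      ⊥-elim (case trans (sym two-apart) (trans (at agree (proj₂ (rim-landmarks {P} ≤-refl))) adjacent′) of λ ())
      where
        two-apart : δ n (rim (q * 3)) (rim (1 + P * 3)) ≡ 2
        two-apart = trans (δ-rim-rim-sym {n} (q * 3) (1 + P * 3)) (δ-rims-two (at-most-9 4 _) (+-monoˡ-≤ (q * 3) e<r))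
        adjacent′ : δ n (rim (2 + P * 3)) (rim (1 + P * 3)) ≡ 1
        adjacent′ = trans (δ-rim-rim-sym {n} (2 + P * 3) (1 + P * 3)) (δ-rims-next l<n)

    rims-determined : ∀ {k l} → k < n → l < n → Agree n W (rim k) (rim l) → k ≡ l
    rims-determined k<n l<n agree with position q r r≤2 k<n
    ... | block t 0 t<q _ refl = sym (rim-landmark agree (proj₁ (rim-landmarks t<q)) refl)
    ... | block t 1 t<q _ refl = sym (rim-landmark agree (proj₂ (rim-landmarks t<q)) refl)
    ... | block t 2 t<q _ refl with δ-rim-rim⁻ (trans (sym (at agree (proj₂ (rim-landmarks t<q)))) adjacent′)
      where
        adjacent′ : δ n (rim (2 + t * 3)) (rim (1 + t * 3)) ≡ 1
        adjacent′ = trans (δ-rim-rim-sym {n} (2 + t * 3) (1 + t * 3)) (δ-rims-next k<n)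
    ...   | adjacent _ (inj₂ l≡a″) = sym (trans l≡a″ (next-block₁ t<q))
    ...   | adjacent _ (inj₁ a+1≡l′) =
      ⊥-elim (m≢2+m _ (sym (rim-landmark (Agree-sym agree) (proj₁ (rim-landmarks t<q))
                                (next-injective (trans (sym a+1≡l′) (sym (next-block₀ t<q)))))))
    rims-determined k<n l<n agree | block t (suc (suc (suc _))) _ (s≤s (s≤s (s≤s ()))) _
    rims-determined k<n l<n agree | tail e e<r refl = rims-in-tail e<r l<n agree

  landmarks-resolve : Resolves (r + (3 + q₀) * 3) (landmarks (3 + q₀) r)
  landmarks-resolve = Resolves-intro determined
    where
      determined : ∀ a b → Valid n a → Valid n b → Agree n W a b → a ≡ b
      determined (spoke i) (spoke j) i<n j<n agree = cong spoke (spokes-determined i<n j<n agree)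
      determined (spoke i) (rim l) _ l<n agree = ⊥-elim (spoke-rim-distinguished l<n agree)
      determined (rim k) (spoke j) k<n _ agree = ⊥-elim (spoke-rim-distinguished k<n (Agree-sym agree))
      determined (rim k) (rim l) k<n l<n agree = cong rim (rims-determined k<n l<n agree)

⌈/3⌉-split : ∀ q r → ⌈ r + q * 3 /3⌉ ≡ (r + 2) / 3 + q
⌈/3⌉-split q r = begin
  (r + q * 3 + 2) / 3        ≡⟨ cong (_/ 3) (swap r (q * 3)) ⟩
  (r + 2 + q * 3) / 3        ≡⟨ +-distrib-/-∣ʳ (r + 2) (n∣m*n q) ⟩
  (r + 2) / 3 + q * 3 / 3    ≡⟨ cong ((r + 2) / 3 +_) (m*n/n≡m q 3) ⟩
  (r + 2) / 3 + q            ∎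
  where
    open ≡-Reasoning
    swap : ∀ a b → a + b + 2 ≡ a + 2 + b
    swap = solve-∀

n≤⌈n/3⌉*3 : ∀ n → n ≤ ⌈ n /3⌉ * 3
n≤⌈n/3⌉*3 n = +-cancelʳ-≤ 2 n (⌈ n /3⌉ * 3) (begin
  n + 2                          ≡⟨ m≡m%n+[m/n]*n (n + 2) 3 ⟩
  (n + 2) % 3 + ⌈ n /3⌉ * 3      ≤⟨ +-monoˡ-≤ _ (s≤s⁻¹ (m%n<n (n + 2) 3)) ⟩
  2 + ⌈ n /3⌉ * 3                ≡⟨ +-comm 2 _ ⟩
  ⌈ n /3⌉ * 3 + 2                ∎)
  where open ≤-Reasoning

[n∸⌈n/3⌉]*3≤n*2 : ∀ n → (n ∸ ⌈ n /3⌉) * 3 ≤ n * 2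
[n∸⌈n/3⌉]*3≤n*2 n = begin
  (n ∸ ⌈ n /3⌉) * 3       ≡⟨ *-distribʳ-∸ 3 n ⌈ n /3⌉ ⟩
  n * 3 ∸ ⌈ n /3⌉ * 3     ≤⟨ ∸-monoʳ-≤ (n * 3) (n≤⌈n/3⌉*3 n) ⟩
  n * 3 ∸ n               ≡⟨ cong (_∸ n) (three n) ⟩
  n * 2 + n ∸ n           ≡⟨ m+n∸n≡m (n * 2) n ⟩
  n * 2                   ∎
  where
    open ≤-Reasoning
    three : ∀ n → n * 3 ≡ n * 2 + n
    three = solve-∀

lower-bound : ∀ n → 3 ≤ n → ∀ W → All (Valid n) W → Resolves n W → n ∸ ⌈ n /3⌉ ≤ length W
lower-bound n 3≤n W ps R = s≤s⁻¹ (*-cancelˡ-< 6 _ _ (begin-strict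
  6 * t                  ≡⟨ sixfold t ⟩
  2 * (t * 3)            ≤⟨ *-monoʳ-≤ 2 ([n∸⌈n/3⌉]*3≤n*2 n) ⟩
  2 * (n * 2)            ≡⟨ fourfold n ⟩
  n * 4                  <⟨ m<m+n (n * 4) (s≤s z≤n) ⟩
  n * 4 + 2              ≤⟨ +-monoˡ-≤ 2 (counting-bound 3≤n ps R) ⟩
  6 * length W + 4 + 2   ≡⟨ regroup (length W) ⟩
  6 * suc (length W)     ∎))
  where
    open ≤-Reasoning
    t : ℕ
    t = n ∸ ⌈ n /3⌉
    sixfold : ∀ t → 6 * t ≡ 2 * (t * 3)
    sixfold = solve-∀
    fourfold : ∀ n → 2 * (n * 2) ≡ n * 4
    fourfold = solve-∀
    regroup : ∀ L → 6 * L + 4 + 2 ≡ 6 * suc L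
    regroup = solve-∀

landmarks-size : ∀ q r → r ≤ 2 → length (landmarks q r) ≡ (r + q * 3) ∸ ⌈ r + q * 3 /3⌉
landmarks-size q r r≤2 =
  trans (length-landmarks q r) (sym (trans (cong ((r + q * 3) ∸_) (⌈/3⌉-split q r)) (by-residue r r≤2)))
  where
    thirds : q * 3 ∸ q ≡ q * 2
    thirds = trans (cong (_∸ q) (three q)) (m+n∸n≡m (q * 2) q)
      where
        three : ∀ q → q * 3 ≡ q * 2 + q
        three = solve-∀
    by-residue : ∀ r → r ≤ 2 → (r + q * 3) ∸ ((r + 2) / 3 + q) ≡ q * 2 + length (tailSpoke r q)
    by-residue 0 _ = trans thirds (sym (+-identityʳ _))
    by-residue 1 _ = trans thirds (sym (+-identityʳ _))
    by-residue 2 _ = trans (+-∸-assoc 1 (m≤m*n q 3)) (trans (cong suc thirds) (+-comm 1 _))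
    by-residue (suc (suc (suc _))) (s≤s (s≤s ()))

large-resolving-set : ∀ q₀ r → r ≤ 2 →
  let n = r + (3 + q₀) * 3 in ResolvingSetOfSize n (n ∸ ⌈ n /3⌉)
large-resolving-set q₀ r r≤2 =
  landmarks (3 + q₀) r , landmarks-valid (3 + q₀) r r≤2 , landmarks-resolve q₀ r r≤2 , landmarks-size (3 + q₀) r r≤2

decompose-by-3 : ∀ n → 9 ≤ n → ∃ λ q₀ → ∃ λ r → r ≤ 2 × n ≡ r + (3 + q₀) * 3
decompose-by-3 n 9≤n = n / 3 ∸ 3 , n % 3 , s≤s⁻¹ (m%n<n n 3) ,
  trans (m≡m%n+[m/n]*n n 3) (cong (λ q → n % 3 + q * 3) (sym (m+[n∸m]≡n (/-monoˡ-≤ 3 9≤n))))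

optimal-resolving-set : ∀ n → 6 ≤ n → ResolvingSetOfSize n (n ∸ ⌈ n /3⌉)
optimal-resolving-set 0 ()
optimal-resolving-set 1 (s≤s ())
optimal-resolving-set 2 (s≤s (s≤s ()))
optimal-resolving-set 3 (s≤s (s≤s (s≤s ())))
optimal-resolving-set 4 (s≤s (s≤s (s≤s (s≤s ()))))
optimal-resolving-set 5 (s≤s (s≤s (s≤s (s≤s (s≤s ())))))
optimal-resolving-set 6 _ = resolving-set-by-computation (rim 0 ∷ rim 1 ∷ rim 3 ∷ rim 4 ∷ []) _ _
optimal-resolving-set 7 _ = resolving-set-by-computation (rim 0 ∷ rim 1 ∷ rim 3 ∷ rim 4 ∷ []) _ _
optimal-resolving-set 8 _ = resolving-set-by-computation (rim 0 ∷ rim 1 ∷ rim 3 ∷ rim 4 ∷ spoke 6 ∷ []) _ _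
optimal-resolving-set n@(suc (suc (suc (suc (suc (suc (suc (suc (suc _))))))))) _
  with decompose-by-3 n (s≤s (s≤s (s≤s (s≤s (s≤s (s≤s (s≤s (s≤s (s≤s z≤n)))))))))
... | q₀ , r , r≤2 , n≡ = subst (λ m → ResolvingSetOfSize m (m ∸ ⌈ m /3⌉)) (sym n≡) (large-resolving-set q₀ r r≤2)

corollary2p11 :
    (∀ n → 3 ≤ n → n ≤ 4 → MetricDim (LineWheel n) 3) ×
    MetricDim (LineWheel 5) 4 ×
    (∀ n → 6 ≤ n → MetricDim (LineWheel n) (n ∸ ⌈ n /3⌉))
corollary2p11 = small-wheels , wheel-5 , large-wheels
  where
    three-spokes : List Edge
    three-spokes = spoke 0 ∷ spoke 1 ∷ spoke 2 ∷ []

    small-wheels : ∀ n → 3 ≤ n → n ≤ 4 → MetricDim (LineWheel n) 3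
    small-wheels 3 3≤n _ =
      LineWheel-MetricDim 3≤n 3 (resolving-set-by-computation three-spokes _ _) (lower-bound-by-computation 2 _)
    small-wheels 4 3≤n _ =
      LineWheel-MetricDim 3≤n 3 (resolving-set-by-computation three-spokes _ _) (lower-bound-by-computation 2 _)
    small-wheels 0 () _
    small-wheels 1 (s≤s ()) _
    small-wheels 2 (s≤s (s≤s ())) _
    small-wheels (suc (suc (suc (suc (suc _))))) _ (s≤s (s≤s (s≤s (s≤s ()))))

    wheel-5 : MetricDim (LineWheel 5) 4
    wheel-5 = LineWheel-MetricDim (s≤s (s≤s (s≤s z≤n))) 4
      (resolving-set-by-computation (spoke 0 ∷ spoke 1 ∷ spoke 2 ∷ spoke 3 ∷ []) _ _) (lower-bound-by-computation 3 _)

    large-wheels : ∀ n → 6 ≤ n → MetricDim (LineWheel n) (n ∸ ⌈ n /3⌉)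
    large-wheels n 6≤n =
      LineWheel-MetricDim 3≤n _ (optimal-resolving-set n 6≤n) (lower-bound n 3≤n)
      where
        3≤n : 3 ≤ n
        3≤n = ≤-trans (s≤s (s≤s (s≤s z≤n))) 6≤n
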